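{- Let $n\ge0$ be an integer, $\beta$ a complex number, and $G_n^\beta=U_nE^{n\beta}U_n^{ -1}$ acting on the space $\mathcal P_n$ of complex polynomials of degree at most $n$. Then $$G_n^\beta=V_n^{ -1}\,B_{n\beta}\,V_n ,$$ where $B_{n\beta}$ is the operator $x^p\mapsto\sum_{i=0}^{p}\binom{n\beta}{p-i}x^i$ on $\mathcal P_n$ (the transpose of the Riordan array $((1+x)^{n\beta},x)$, truncated to $\mathcal P_n$).
   Context: The Euler polynomials $A_k(x)$ are defined by $\frac{A_k(x)}{(1-x)^{k+1}}=\sum_{m\ge0}m^kx^m$, with $A_0=1$. Operators on $\mathcal P_n$, given on $x^p$, $p=0,\dots,n$: $U_n x^p=\frac1{n!}(1-x)^{n-p}A_p(x)$ (invertible, with $U_n^{ -1}x^p=(x)_p[x+1]_{n-p}$, falling and rising factorials); $E^{c}f(x)=f(x+c)$; $V_nx^p=(1+x)^{n-p}x^p$ (so $V_n^{ -1}x^p=(1-x)^{n-p}x^p$). $\binom{c}{k}=c(c-1)\cdots(c-k+1)/k!$ for complex $c$. -}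

module Defs where

open import Algebra.Bundles using (CommutativeRing)
open import Data.Nat using (ℕ; zero; suc; _∸_)
open import Data.Fin using (Fin; toℕ)
open import Data.List using (List; []; _∷_; map; foldr; take; tabulate; allFin)

-- Everything is developed over an arbitrary commutative ring R in which
-- every positive integer k+1 has a chosen inverse  inv k  (a Q-algebra;
-- e.g. R = ℂ).  The hypothesis  (k+1)·inv k ≈ 1  is imposed in the theorem.
module Ops {c ℓ} (R : CommutativeRing c ℓ) (inv : ℕ → CommutativeRing.Carrier R) where
  open CommutativeRing R

  fromℕ : ℕ → Carrier
  fromℕ zero    = 0#
  fromℕ (suc k) = 1# + fromℕ k

  powR : Carrier → ℕ → Carrier
  powR a zero    = 1#
  powR a (suc k) = a * powR a k

  -- 1 / k!   (inv j = 1/(j+1))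
  invFact : ℕ → Carrier
  invFact zero    = 1#
  invFact (suc k) = inv k * invFact k

  fallR : Carrier → ℕ → Carrier
  fallR a zero    = 1#
  fallR a (suc k) = fallR a k * (a - fromℕ k)

  binom : Carrier → ℕ → Carrier
  binom a k = fallR a k * invFact k

  -- Polynomials as coefficient lists (constant term first)
  Poly : Set c
  Poly = List Carrier

  infixl 6 _⊕_
  _⊕_ : Poly → Poly → Poly
  []      ⊕ q       = q
  (a ∷ p) ⊕ []      = a ∷ p
  (a ∷ p) ⊕ (b ∷ q) = (a + b) ∷ (p ⊕ q)

  scaleP : Carrier → Poly → Poly
  scaleP a = map (a *_)

  infixl 7 _⊛_
  _⊛_ : Poly → Poly → Poly
  []      ⊛ q = []
  (a ∷ p) ⊛ q = scaleP a q ⊕ (0# ∷ (p ⊛ q))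

  constP : Carrier → Poly
  constP a = a ∷ []

  X : Poly
  X = 0# ∷ 1# ∷ []

  powP : Poly → ℕ → Poly
  powP p zero    = constP 1#
  powP p (suc k) = p ⊛ powP p k

  coeff : Poly → ℕ → Carrier
  coeff []      _       = 0#
  coeff (a ∷ p) zero    = a
  coeff (a ∷ p) (suc k) = coeff p k

  oneMinusX onePlusX : Poly
  oneMinusX = 1# ∷ (- 1#) ∷ []
  onePlusX  = 1# ∷ 1# ∷ []

  -- Euler polynomial A_k: A_k(x) = (1-x)^{k+1} Σ_{m≥0} m^k x^m; its degree
  -- is ≤ k, so it is the truncation to degree ≤ k of the product, and only
  -- the series terms m ≤ k contribute to those coefficients.
  euler : ℕ → Poly
  euler k = take (suc k)
    (powP oneMinusX (suc k) ⊛ tabulate {n = suc k} (λ m → powR (fromℕ (toℕ m)) k))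

  fallP : ℕ → Poly
  fallP zero    = constP 1#
  fallP (suc k) = fallP k ⊛ ((- fromℕ k) ∷ 1# ∷ [])

  riseP : ℕ → Poly
  riseP zero    = constP 1#
  riseP (suc k) = riseP k ⊛ (fromℕ (suc k) ∷ 1# ∷ [])

  -- P_n: polynomials of degree ≤ n, as coefficient vectors (index = degree)
  Pn : ℕ → Set c
  Pn n = Fin (suc n) → Carrier

  toPoly : ∀ {n} → Pn n → Poly
  toPoly {n} f = tabulate {n = suc n} f

  fromPoly : ∀ {n} → Poly → Pn n
  fromPoly q i = coeff q (toℕ i)

  linOp : ∀ n → (ℕ → Poly) → Pn n → Pn n
  linOp n img f = fromPoly
    (foldr _⊕_ [] (map (λ p → scaleP (f p) (img (toℕ p))) (allFin (suc n))))

  U : ∀ n → Pn n → Pn n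
  U n = linOp n (λ p → scaleP (invFact n) (powP oneMinusX (n ∸ p) ⊛ euler p))

  Uinv : ∀ n → Pn n → Pn n
  Uinv n = linOp n (λ p → fallP p ⊛ riseP (n ∸ p))

  E : ∀ n → Carrier → Pn n → Pn n
  E n a = linOp n (λ p → powP (a ∷ 1# ∷ []) p)

  V : ∀ n → Pn n → Pn n
  V n = linOp n (λ p → powP onePlusX (n ∸ p) ⊛ powP X p)

  Vinv : ∀ n → Pn n → Pn n
  Vinv n = linOp n (λ p → powP oneMinusX (n ∸ p) ⊛ powP X p)

  B : ∀ n → Carrier → Pn n → Pn n
  B n a = linOp n (λ p → tabulate {n = suc p} (λ i → binom a (p ∸ toℕ i)))

  G : ∀ n → Carrier → Pn n → Pn n
  G n β f = U n (E n (fromℕ n * β) (Uinv n f))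

module Submission where

-- Applied to f ∈ P_n, both sides are
-- polynomials agreeing in degrees ≤ n with the series
--     (1-x)^{n+1} Σ_{m ≤ n} (1/n!) (U_n^{-1} f)(nβ + m) x^m .
-- Left: (1-x)^{n-p} A_p = (1-x)^{n+1} Σ_m m^p x^m (via Newton's expansion
-- m^p = Σ_t surj(p,t) C(m,t)), so U_n turns a coefficient vector v into the
-- series of the values Σ_p v_p m^p, which for v = E^{nβ} U_n^{-1} f are
-- (U_n^{-1} f)(nβ + m).  Right: (1-x)^{n-t} x^t = (1-x)^{n+1} Σ_m C(m,t) x^m, so
-- V_n^{-1} turns d into the series of Σ_t d_t C(m,t); for d = B_{nβ} V_n f,
-- Chu–Vandermonde and  Σ_k [(1+x)^{n-r} x^r]_k C(z,k) = C(z+n-r, n) =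
-- (1/n!)·((x)_r [x+1]_{n-r})(z)  give the same values.

open import Defs
open import Algebra.Bundles using (CommutativeRing)
open import Data.Nat as ℕ using (ℕ; zero; suc; _∸_; _≤_; _<_; z≤n; s≤s)
  renaming (_+_ to _+ℕ_; _*_ to _*ℕ_; _^_ to _^ℕ_)
import Data.Nat.Properties as ℕP
open import Data.Fin as Fin using (Fin; toℕ)
import Data.Fin.Properties as FinP
open import Data.List using (List; []; _∷_; map; foldr; take; tabulate; allFin)
open import Data.List.Properties using (map-tabulate)
open import Data.Sum using (inj₁; inj₂)
open import Level using (_⊔_)
open import Relation.Binary.PropositionalEquality as P using (_≡_)
import Data.Integer as ℤ

-- The canonical ring map ℤ → R, packaged as a morphism so that the
-- standard-library ring solver can be run on R with integer
-- coefficients (which lets it cancel terms such as  a + b - b ).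
module IntegerSolver {c ℓ} (R : CommutativeRing c ℓ) (inv : ℕ → CommutativeRing.Carrier R) where
  open import Data.Integer using (ℤ; -[1+_]; sign; ∣_∣; _◃_; _⊖_) renaming (+_ to ℤ+_)
  import Data.Integer.Properties as ℤP
  open import Data.Sign as Sign using (Sign)
  open import Data.Maybe using (Maybe)
  import Data.Maybe as Maybe
  open import Relation.Binary.Consequences using (dec⇒weaklyDec)
  import Algebra.Solver.Ring.AlmostCommutativeRing as ACR
  import Algebra.Solver.Ring
  import Algebra.Properties.Ring

  open CommutativeRing R
  open Ops R inv using (fromℕ)
  open Algebra.Properties.Ring ring using (-1*x≈-x; -‿involutive; -0#≈0#; -‿+-comm; x≈z//y; ⁻¹-anti-homo‿-)
  open import Algebra.Properties.CommutativeSemigroup *-commutativeSemigroup using (interchange)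
  open import Relation.Binary.Reasoning.Setoid setoid

  fromℕ-+ : ∀ m n → fromℕ (m +ℕ n) ≈ fromℕ m + fromℕ n
  fromℕ-+ zero    n = sym (+-identityˡ _)
  fromℕ-+ (suc m) n = trans (+-congˡ (fromℕ-+ m n)) (sym (+-assoc _ _ _))

  fromℕ-* : ∀ m n → fromℕ (m *ℕ n) ≈ fromℕ m * fromℕ n
  fromℕ-* zero    n = sym (zeroˡ _)
  fromℕ-* (suc m) n = begin
    fromℕ (n +ℕ m *ℕ n)              ≈⟨ fromℕ-+ n (m *ℕ n) ⟩
    fromℕ n + fromℕ (m *ℕ n)         ≈⟨ +-cong (sym (*-identityˡ _)) (fromℕ-* m n) ⟩
    1# * fromℕ n + fromℕ m * fromℕ n ≈⟨ sym (distribʳ _ _ _) ⟩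
    (1# + fromℕ m) * fromℕ n         ∎

  ⟦_⟧ℤ : ℤ → Carrier
  ⟦ ℤ+ n ⟧ℤ    = fromℕ n
  ⟦ -[1+ n ] ⟧ℤ = - fromℕ (suc n)

  ⟦_⟧± : Sign → Carrier
  ⟦ Sign.+ ⟧± = 1#
  ⟦ Sign.- ⟧± = - 1#

  ⟦-⟧ℤ : ∀ i → ⟦ ℤ.- i ⟧ℤ ≈ - ⟦ i ⟧ℤ
  ⟦-⟧ℤ -[1+ n ]     = sym (-‿involutive _)
  ⟦-⟧ℤ (ℤ+ zero)    = sym -0#≈0#
  ⟦-⟧ℤ (ℤ+ (suc n)) = refl

  ⟦⊖⟧ℤ : ∀ m n → ⟦ m ⊖ n ⟧ℤ ≈ fromℕ m - fromℕ n
  ⟦⊖⟧ℤ m n with ℕP.≤-total n m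
  ... | inj₁ n≤m rewrite ℤP.⊖-≥ n≤m = x≈z//y _ _ _ (begin
        fromℕ (m ∸ n) + fromℕ n ≈⟨ sym (fromℕ-+ (m ∸ n) n) ⟩
        fromℕ (m ∸ n +ℕ n)      ≡⟨ P.cong fromℕ (ℕP.m∸n+n≡m n≤m) ⟩
        fromℕ m                 ∎)
  ... | inj₂ m≤n rewrite ℤP.⊖-≤ m≤n = begin
        ⟦ ℤ.- ℤ+ (n ∸ m) ⟧ℤ                    ≈⟨ ⟦-⟧ℤ (ℤ+ (n ∸ m)) ⟩
        - fromℕ (n ∸ m)                         ≈⟨ -‿cong (x≈z//y _ _ _ (begin
            fromℕ (n ∸ m) + fromℕ m               ≈⟨ sym (fromℕ-+ (n ∸ m) m) ⟩
            fromℕ (n ∸ m +ℕ m)                    ≡⟨ P.cong fromℕ (ℕP.m∸n+n≡m m≤n) ⟩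
            fromℕ n                               ∎)) ⟩
        - (fromℕ n - fromℕ m)                   ≈⟨ ⁻¹-anti-homo‿- _ _ ⟩
        fromℕ m - fromℕ n                       ∎

  ⟦+⟧ℤ : ∀ i j → ⟦ i ℤ.+ j ⟧ℤ ≈ ⟦ i ⟧ℤ + ⟦ j ⟧ℤ
  ⟦+⟧ℤ -[1+ m ] -[1+ n ] = begin
    - fromℕ (suc (suc (m +ℕ n)))      ≡⟨ P.cong (λ k → - fromℕ (suc k)) (P.sym (ℕP.+-suc m n)) ⟩
    - fromℕ (suc m +ℕ suc n)          ≈⟨ -‿cong (fromℕ-+ (suc m) (suc n)) ⟩
    - (fromℕ (suc m) + fromℕ (suc n)) ≈⟨ sym (-‿+-comm _ _) ⟩
    - fromℕ (suc m) + - fromℕ (suc n) ∎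
  ⟦+⟧ℤ -[1+ m ] (ℤ+ n) = trans (⟦⊖⟧ℤ n (suc m)) (+-comm _ _)
  ⟦+⟧ℤ (ℤ+ m) -[1+ n ] = ⟦⊖⟧ℤ m (suc n)
  ⟦+⟧ℤ (ℤ+ m) (ℤ+ n)   = fromℕ-+ m n

  ⟦*⟧± : ∀ s t → ⟦ s Sign.* t ⟧± ≈ ⟦ s ⟧± * ⟦ t ⟧±
  ⟦*⟧± Sign.- Sign.- = sym (trans (-1*x≈-x _) (-‿involutive _))
  ⟦*⟧± Sign.- Sign.+ = sym (*-identityʳ _)
  ⟦*⟧± Sign.+ t      = sym (*-identityˡ _)

  ⟦◃⟧ℤ : ∀ s n → ⟦ s ◃ n ⟧ℤ ≈ ⟦ s ⟧± * fromℕ n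
  ⟦◃⟧ℤ s      zero    = sym (zeroʳ _)
  ⟦◃⟧ℤ Sign.- (suc n) = sym (-1*x≈-x _)
  ⟦◃⟧ℤ Sign.+ (suc n) = sym (*-identityˡ _)

  ⟦*⟧ℤ : ∀ i j → ⟦ i ℤ.* j ⟧ℤ ≈ ⟦ i ⟧ℤ * ⟦ j ⟧ℤ
  ⟦*⟧ℤ i j = begin
    ⟦ (sign i Sign.* sign j) ◃ (∣ i ∣ *ℕ ∣ j ∣) ⟧ℤ         ≈⟨ ⟦◃⟧ℤ (sign i Sign.* sign j) (∣ i ∣ *ℕ ∣ j ∣) ⟩
    ⟦ sign i Sign.* sign j ⟧± * fromℕ (∣ i ∣ *ℕ ∣ j ∣)     ≈⟨ *-cong (⟦*⟧± (sign i) (sign j)) (fromℕ-* ∣ i ∣ ∣ j ∣) ⟩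
    (⟦ sign i ⟧± * ⟦ sign j ⟧±) * (fromℕ ∣ i ∣ * fromℕ ∣ j ∣) ≈⟨ interchange _ _ _ _ ⟩
    (⟦ sign i ⟧± * fromℕ ∣ i ∣) * (⟦ sign j ⟧± * fromℕ ∣ j ∣) ≈⟨ sym (*-cong (signAbs i) (signAbs j)) ⟩
    ⟦ i ⟧ℤ * ⟦ j ⟧ℤ                                          ∎
    where
    signAbs : ∀ k → ⟦ k ⟧ℤ ≈ ⟦ sign k ⟧± * fromℕ ∣ k ∣
    signAbs k = trans (reflexive (P.cong ⟦_⟧ℤ (P.sym (ℤP.◃-inverse k)))) (⟦◃⟧ℤ (sign k) ∣ k ∣)

  -- The solver needs the constant 1 to denote  1#  on the nose, whereas
  -- fromℕ 1 = 1# + 0#; so the morphism uses this variant of ⟦_⟧ℤ.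
  literal : ℕ → Carrier
  literal zero          = 0#
  literal (suc zero)    = 1#
  literal (suc (suc n)) = 1# + literal (suc n)

  literal≈fromℕ : ∀ n → literal n ≈ fromℕ n
  literal≈fromℕ zero          = refl
  literal≈fromℕ (suc zero)    = sym (+-identityʳ 1#)
  literal≈fromℕ (suc (suc n)) = +-congˡ (literal≈fromℕ (suc n))

  ⟦_⟧ : ℤ → Carrier
  ⟦ ℤ+ n ⟧    = literal n
  ⟦ -[1+ n ] ⟧ = - literal (suc n)

  ⟦⟧≈⟦⟧ℤ : ∀ i → ⟦ i ⟧ ≈ ⟦ i ⟧ℤ
  ⟦⟧≈⟦⟧ℤ (ℤ+ n)    = literal≈fromℕ n
  ⟦⟧≈⟦⟧ℤ -[1+ n ] = -‿cong (literal≈fromℕ (suc n))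

  ACRing : ACR.AlmostCommutativeRing c ℓ
  ACRing = ACR.fromCommutativeRing R

  ℤ⟶R : ℤ.+-*-rawRing ACR.-Raw-AlmostCommutative⟶ ACRing
  ℤ⟶R = record
    { ⟦_⟧    = ⟦_⟧
    ; +-homo = λ i j → transport (i ℤ.+ j) (⟦+⟧ℤ i j) (+-cong (⟦⟧≈⟦⟧ℤ i) (⟦⟧≈⟦⟧ℤ j))
    ; *-homo = λ i j → transport (i ℤ.* j) (⟦*⟧ℤ i j) (*-cong (⟦⟧≈⟦⟧ℤ i) (⟦⟧≈⟦⟧ℤ j))
    ; -‿homo = λ i → transport (ℤ.- i) (⟦-⟧ℤ i) (-‿cong (⟦⟧≈⟦⟧ℤ i))
    ; 0-homo = refl
    ; 1-homo = refl
    }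
    where
    transport : ∀ i {x y} → ⟦ i ⟧ℤ ≈ x → y ≈ x → ⟦ i ⟧ ≈ y
    transport i e e' = trans (⟦⟧≈⟦⟧ℤ i) (trans e (sym e'))

  equal? : ∀ i j → Maybe (⟦ i ⟧ ≈ ⟦ j ⟧)
  equal? i j = Maybe.map (λ { P.refl → refl }) (dec⇒weaklyDec ℤ._≟_ i j)

  open Algebra.Solver.Ring ℤ.+-*-rawRing ACRing ℤ⟶R equal? public
    using (solve; _:=_; _:+_; _:*_; :-_; _:-_; con)

module NewtonExpansion where
  open import Data.Nat using (_+_; _*_; _^_)
  open import Data.Nat.Tactic.RingSolver using (solve-∀)

  choose : ℕ → ℕ → ℕ
  choose zero    zero    = 1
  choose zero    (suc t) = 0
  choose (suc m) zero    = 1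
  choose (suc m) (suc t) = choose m t + choose m (suc t)

  choose-0 : ∀ m → choose m 0 ≡ 1
  choose-0 zero    = P.refl
  choose-0 (suc m) = P.refl

  choose-1 : ∀ m → choose m 1 ≡ m
  choose-1 zero    = P.refl
  choose-1 (suc m) = P.cong₂ _+_ (choose-0 m) (choose-1 m)

  absorb : ∀ m t → m * choose m t ≡ suc t * choose m (suc t) + t * choose m t
  absorb zero    zero    = P.refl
  absorb zero    (suc t) = P.sym (P.cong₂ _+_ (ℕP.*-zeroʳ (suc (suc t))) (ℕP.*-zeroʳ (suc t)))
  absorb (suc m) zero rewrite choose-0 m | choose-1 m = base m
    where
    base : ∀ m → suc m * 1 ≡ 1 * suc m + 0 * 1
    base = solve-∀
  absorb (suc m) (suc t) = begin
    suc m * (c₀ + c₁)                                     ≡⟨ expand m c₀ c₁ ⟩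
    (m * c₀ + c₀) + (m * c₁ + c₁)
      ≡⟨ P.cong₂ (λ x y → (x + c₀) + (y + c₁)) (absorb m t) (absorb m (suc t)) ⟩
    ((suc t * c₁ + t * c₀) + c₀) + ((suc (suc t) * c₂ + suc t * c₁) + c₁)
      ≡⟨ regroup t c₀ c₁ c₂ ⟩
    suc (suc t) * (c₁ + c₂) + suc t * (c₀ + c₁)           ∎
    where
    open P.≡-Reasoning
    c₀ = choose m t
    c₁ = choose m (suc t)
    c₂ = choose m (suc (suc t))
    expand : ∀ m x y → suc m * (x + y) ≡ (m * x + x) + (m * y + y)
    expand = solve-∀
    regroup : ∀ t a b c → ((suc t * b + t * a) + a) + ((suc (suc t) * c + suc t * b) + b)
                          ≡ suc (suc t) * (b + c) + suc t * (a + b)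
    regroup = solve-∀

  ΣN : ℕ → (ℕ → ℕ) → ℕ
  ΣN zero    h = 0
  ΣN (suc N) h = h 0 + ΣN N (λ j → h (suc j))

  ΣN-cong : ∀ N {h h′} → (∀ j → h j ≡ h′ j) → ΣN N h ≡ ΣN N h′
  ΣN-cong zero    e = P.refl
  ΣN-cong (suc N) e = P.cong₂ _+_ (e 0) (ΣN-cong N (λ j → e (suc j)))

  ΣN-+ : ∀ N h g → ΣN N (λ j → h j + g j) ≡ ΣN N h + ΣN N g
  ΣN-+ zero    h g = P.refl
  ΣN-+ (suc N) h g = P.trans (P.cong ((h 0 + g 0) +_) (ΣN-+ N (λ j → h (suc j)) (λ j → g (suc j))))
    (interchange (h 0) (g 0) (ΣN N (λ j → h (suc j))) (ΣN N (λ j → g (suc j))))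
    where
    interchange : ∀ a b c d → (a + b) + (c + d) ≡ (a + c) + (b + d)
    interchange = solve-∀

  ΣN-*ˡ : ∀ N a h → ΣN N (λ j → a * h j) ≡ a * ΣN N h
  ΣN-*ˡ zero    a h = P.sym (ℕP.*-zeroʳ a)
  ΣN-*ˡ (suc N) a h = P.trans (P.cong (a * h 0 +_) (ΣN-*ˡ N a (λ j → h (suc j)))) (P.sym (ℕP.*-distribˡ-+ a (h 0) _))

  ΣN-last : ∀ N h → ΣN (suc N) h ≡ ΣN N h + h N
  ΣN-last zero    h = ℕP.+-comm (h 0) 0
  ΣN-last (suc N) h = P.trans (P.cong (h 0 +_) (ΣN-last N (λ j → h (suc j)))) (P.sym (ℕP.+-assoc (h 0) _ _))

  -- surj p t = number of surjections from a p-set onto a t-set ( = t!·S(p,t) ),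
  -- given by its recursion on the image of the last element
  surj : ℕ → ℕ → ℕ
  surj zero    zero    = 1
  surj zero    (suc t) = 0
  surj (suc p) zero    = 0
  surj (suc p) (suc t) = suc t * (surj p t + surj p (suc t))

  surj-vanish : ∀ p t → p < t → surj p t ≡ 0
  surj-vanish zero    (suc t) _         = P.refl
  surj-vanish (suc p) (suc t) (s≤s p<t)
    rewrite surj-vanish p t p<t | surj-vanish p (suc t) (ℕP.m≤n⇒m≤1+n p<t) = ℕP.*-zeroʳ (suc t)

  newton : ∀ p m → m ^ p ≡ ΣN (suc p) (λ t → surj p t * choose m t)
  newton zero    m = P.cong (λ x → (x + 0) + 0) (P.sym (choose-0 m))
  newton (suc p) m = begin
    m * m ^ p
      ≡⟨ P.cong (m *_) (newton p m) ⟩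
    m * ΣN (suc p) (λ t → a t * C t)
      ≡⟨ P.sym (ΣN-*ˡ (suc p) m (λ t → a t * C t)) ⟩
    ΣN (suc p) (λ t → m * (a t * C t))
      ≡⟨ ΣN-cong (suc p) absorb-term ⟩
    ΣN (suc p) (λ t → suc t * a t * C (suc t) + t * a t * C t)
      ≡⟨ ΣN-+ (suc p) (λ t → suc t * a t * C (suc t)) (λ t → t * a t * C t) ⟩
    ΣN (suc p) (λ t → suc t * a t * C (suc t)) + ΣN (suc p) (λ t → t * a t * C t)
      ≡⟨ P.cong (ΣN (suc p) (λ t → suc t * a t * C (suc t)) +_) reindex ⟩
    ΣN (suc p) (λ t → suc t * a t * C (suc t)) + ΣN (suc p) shifted
      ≡⟨ P.sym (ΣN-+ (suc p) (λ t → suc t * a t * C (suc t)) shifted) ⟩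
    ΣN (suc p) (λ t → suc t * a t * C (suc t) + shifted t)
      ≡⟨ ΣN-cong (suc p) (λ t → collect (suc t) (a t) (a (suc t)) (C (suc t))) ⟩
    ΣN (suc p) (λ t → surj (suc p) (suc t) * C (suc t)) ∎
    where
    open P.≡-Reasoning
    a = surj p
    C = choose m
    absorb-term : ∀ t → m * (a t * C t) ≡ suc t * a t * C (suc t) + t * a t * C t
    absorb-term t = P.trans (swap m (a t) (C t))
      (P.trans (P.cong (a t *_) (absorb m t)) (distrib (a t) (suc t) t (C (suc t)) (C t)))
      where
      swap : ∀ x y z → x * (y * z) ≡ y * (x * z)
      swap = solve-∀
      distrib : ∀ x u v y z → x * (u * y + v * z) ≡ u * x * y + v * x * z
      distrib = solve-∀
    collect : ∀ u x y z → u * x * z + u * y * z ≡ u * (x + y) * z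
    collect = solve-∀
    shifted : ℕ → ℕ
    shifted t = suc t * a (suc t) * C (suc t)
    -- the t = 0 term of the left sum vanishes, and so does the new top term
    -- on the right, as  surj p (p+1) = 0
    reindex : ΣN (suc p) (λ t → t * a t * C t) ≡ ΣN (suc p) shifted
    reindex = P.sym (begin
      ΣN (suc p) shifted        ≡⟨ ΣN-last p shifted ⟩
      ΣN p shifted + shifted p  ≡⟨ P.cong (ΣN p shifted +_) top-vanishes ⟩
      ΣN p shifted + 0          ≡⟨ ℕP.+-identityʳ _ ⟩
      ΣN p shifted              ∎)
      where
      top-vanishes : shifted p ≡ 0
      top-vanishes = P.trans (P.cong (λ x → suc p * x * C (suc p)) (surj-vanish p (suc p) ℕP.≤-refl))
                             (P.cong (_* C (suc p)) (ℕP.*-zeroʳ (suc p)))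

open NewtonExpansion

module Polynomials {c ℓ} (R : CommutativeRing c ℓ) (inv : ℕ → CommutativeRing.Carrier R) where
  open CommutativeRing R
  open Ops R inv
  open IntegerSolver R inv public using (solve; _:=_; _:+_; _:*_; _:-_; :-_; con; fromℕ-+; fromℕ-*)
  open import Relation.Binary.Reasoning.Setoid setoid public

  open import Algebra.Properties.CommutativeSemigroup *-commutativeSemigroup public using (x∙yz≈y∙xz)
  open import Algebra.Properties.CommutativeSemigroup +-commutativeSemigroup public
    using () renaming (interchange to +-interchange; x∙yz≈y∙xz to x+[y+z]≈y+[x+z])

  ΣL : ∀ {a} {I : Set a} → List I → (I → Carrier) → Carrier
  ΣL xs g = foldr _+_ 0# (map g xs)

  ΣL-cong : ∀ {a} {I : Set a} (xs : List I) {g g′ : I → Carrier} → (∀ x → g x ≈ g′ x) → ΣL xs g ≈ ΣL xs g′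
  ΣL-cong []       e = refl
  ΣL-cong (x ∷ xs) e = +-cong (e x) (ΣL-cong xs e)

  ΣL-*ˡ : ∀ {a} {I : Set a} (xs : List I) b g → ΣL xs (λ x → b * g x) ≈ b * ΣL xs g
  ΣL-*ˡ []       b g = sym (zeroʳ b)
  ΣL-*ˡ (x ∷ xs) b g = trans (+-congˡ (ΣL-*ˡ xs b g)) (sym (distribˡ _ _ _))

  -- Σ< N h  =  h 0 + … + h (N-1).  It is opaque so that unification
  -- never unfolds  Σ< (suc k) h ; its recursion equations are exported.
  opaque
    Σ< : ℕ → (ℕ → Carrier) → Carrier
    Σ< zero    h = 0#
    Σ< (suc N) h = h 0 + Σ< N (λ j → h (suc j))

    Σ<-cong : ∀ N {h h′ : ℕ → Carrier} → (∀ j → j < N → h j ≈ h′ j) → Σ< N h ≈ Σ< N h′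
    Σ<-cong zero    e = refl
    Σ<-cong (suc N) e = +-cong (e 0 (s≤s z≤n)) (Σ<-cong N (λ j j< → e (suc j) (s≤s j<)))

    Σ<-zero : ∀ N {h : ℕ → Carrier} → (∀ j → j < N → h j ≈ 0#) → Σ< N h ≈ 0#
    Σ<-zero N e = trans (Σ<-cong N e) (zeros N)
      where
      zeros : ∀ N → Σ< N (λ _ → 0#) ≈ 0#
      zeros zero    = refl
      zeros (suc N) = trans (+-identityˡ _) (zeros N)

    Σ<-+ : ∀ N h g → Σ< N (λ j → h j + g j) ≈ Σ< N h + Σ< N g
    Σ<-+ zero    h g = sym (+-identityʳ 0#)
    Σ<-+ (suc N) h g = trans (+-congˡ (Σ<-+ N _ _))
      (+-interchange _ _ _ _)

    Σ<-*ˡ : ∀ N a h → Σ< N (λ j → a * h j) ≈ a * Σ< N h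
    Σ<-*ˡ zero    a h = sym (zeroʳ a)
    Σ<-*ˡ (suc N) a h = trans (+-congˡ (Σ<-*ˡ N a _)) (sym (distribˡ _ _ _))

    Σ<-suc : ∀ N h → Σ< (suc N) h ≡ h 0 + Σ< N (λ j → h (suc j))
    Σ<-suc N h = P.refl

    Σ<-0 : ∀ h → Σ< 0 h ≡ 0#
    Σ<-0 h = P.refl

    ΣL-allFin : ∀ N H → ΣL (allFin N) (λ i → H (toℕ i)) ≡ Σ< N H
    ΣL-allFin N H = P.trans (P.cong (foldr _+_ 0#) (map-tabulate {n = N} (λ i → i) (λ i → H (toℕ i)))) (go N H)
      where
      go : ∀ N H → foldr _+_ 0# (tabulate {n = N} (λ i → H (toℕ i))) ≡ Σ< N H
      go zero    H = P.refl
      go (suc N) H = P.cong (H 0 +_) (go N (λ j → H (suc j)))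

  -- equality of polynomials coefficientwise, and agreement in degrees ≤ N
  -- (records, so that the polynomials compared remain inferable)
  infix 4 _≋_ _≈[_]_
  record _≋_ (p q : Poly) : Set ℓ where
    constructor mk≋
    field get≋ : ∀ k → coeff p k ≈ coeff q k
  open _≋_ public

  record _≈[_]_ (p : Poly) (N : ℕ) (q : Poly) : Set ℓ where
    constructor mk≈[]
    field get≈[] : ∀ k → k ≤ N → coeff p k ≈ coeff q k
  open _≈[_]_ public

  ≋-refl : ∀ {p} → p ≋ p
  ≋-refl = mk≋ λ k → refl

  ≋-sym : ∀ {p q} → p ≋ q → q ≋ p
  ≋-sym e = mk≋ λ k → sym (get≋ e k)

  ≋-trans : ∀ {p q r} → p ≋ q → q ≋ r → p ≋ r
  ≋-trans e f = mk≋ λ k → trans (get≋ e k) (get≋ f k)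

  ≋⇒≈[] : ∀ {p q N} → p ≋ q → p ≈[ N ] q
  ≋⇒≈[] e = mk≈[] λ k _ → get≋ e k

  ≈[]-sym : ∀ {p q N} → p ≈[ N ] q → q ≈[ N ] p
  ≈[]-sym e = mk≈[] λ k k≤ → sym (get≈[] e k k≤)

  ≈[]-trans : ∀ {p q r N} → p ≈[ N ] q → q ≈[ N ] r → p ≈[ N ] r
  ≈[]-trans e f = mk≈[] λ k k≤ → trans (get≈[] e k k≤) (get≈[] f k k≤)

  coeff-⊕ : ∀ p q k → coeff (p ⊕ q) k ≈ coeff p k + coeff q k
  coeff-⊕ []      q       k       = sym (+-identityˡ _)
  coeff-⊕ (a ∷ p) []      k       = sym (+-identityʳ _)
  coeff-⊕ (a ∷ p) (b ∷ q) zero    = refl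
  coeff-⊕ (a ∷ p) (b ∷ q) (suc k) = coeff-⊕ p q k

  coeff-scale : ∀ a p k → coeff (scaleP a p) k ≈ a * coeff p k
  coeff-scale a []      k       = sym (zeroʳ a)
  coeff-scale a (b ∷ p) zero    = refl
  coeff-scale a (b ∷ p) (suc k) = coeff-scale a p k

  ∷-cong : ∀ {a b p q} → a ≈ b → p ≋ q → (a ∷ p) ≋ (b ∷ q)
  ∷-cong e f = mk≋ λ { zero → e ; (suc k) → get≋ f k }

  ⊕-cong : ∀ {p p′ q q′} → p ≋ p′ → q ≋ q′ → (p ⊕ q) ≋ (p′ ⊕ q′)
  ⊕-cong {p} {p′} {q} {q′} e f = mk≋ λ k →
    trans (coeff-⊕ p q k) (trans (+-cong (get≋ e k) (get≋ f k)) (sym (coeff-⊕ p′ q′ k)))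

  scale-cong-≈[] : ∀ {a p q N} → p ≈[ N ] q → scaleP a p ≈[ N ] scaleP a q
  scale-cong-≈[] {a} {p} {q} f = mk≈[] λ k k≤ →
    trans (coeff-scale a p k) (trans (*-congˡ (get≈[] f k k≤)) (sym (coeff-scale a q k)))

  coeff-⊛ : ∀ p q k → coeff (p ⊛ q) k ≈ Σ< (suc k) (λ j → coeff p j * coeff q (k ∸ j))
  coeff-⊛ []      q k       = sym (Σ<-zero (suc k) (λ j _ → zeroˡ _))
  coeff-⊛ (a ∷ p) q zero    = trans (coeff-⊕ (scaleP a q) (0# ∷ (p ⊛ q)) 0)
    (trans (+-cong (coeff-scale a q 0) (sym (reflexive (Σ<-0 _)))) (sym (reflexive (Σ<-suc 0 _))))
  coeff-⊛ (a ∷ p) q (suc k) = trans (coeff-⊕ (scaleP a q) (0# ∷ (p ⊛ q)) (suc k))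
    (trans (+-cong (coeff-scale a q (suc k)) (coeff-⊛ p q k)) (sym (reflexive (Σ<-suc (suc k) _))))

  -- coefficient k of a product only involves coefficients of degree ≤ k
  ⊛-congʳ-≈[] : ∀ p {q q′ N} → q ≈[ N ] q′ → (p ⊛ q) ≈[ N ] (p ⊛ q′)
  ⊛-congʳ-≈[] p {q} {q′} e = mk≈[] λ k k≤ → trans (coeff-⊛ p q k) (trans
    (Σ<-cong (suc k) (λ j _ → *-congˡ (get≈[] e (k ∸ j) (ℕP.≤-trans (ℕP.m∸n≤m k j) k≤))))
    (sym (coeff-⊛ p q′ k)))

  ⊛-congˡ-≈[] : ∀ {p p′} q {N} → p ≈[ N ] p′ → (p ⊛ q) ≈[ N ] (p′ ⊛ q)
  ⊛-congˡ-≈[] {p} {p′} q e = mk≈[] λ k k≤ → trans (coeff-⊛ p q k) (trans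
    (Σ<-cong (suc k) (λ j j< → *-congʳ (get≈[] e j (ℕP.≤-trans (ℕP.≤-pred j<) k≤))))
    (sym (coeff-⊛ p′ q k)))

  ⊛-congʳ : ∀ p {q q′} → q ≋ q′ → (p ⊛ q) ≋ (p ⊛ q′)
  ⊛-congʳ p e = mk≋ λ k → get≈[] (⊛-congʳ-≈[] p {N = k} (≋⇒≈[] e)) k ℕP.≤-refl

  ⊛-congˡ : ∀ {p p′} q → p ≋ p′ → (p ⊛ q) ≋ (p′ ⊛ q)
  ⊛-congˡ q e = mk≋ λ k → get≈[] (⊛-congˡ-≈[] q {N = k} (≋⇒≈[] e)) k ℕP.≤-refl

  ⊛-distribˡ : ∀ p q q′ → (p ⊛ (q ⊕ q′)) ≋ ((p ⊛ q) ⊕ (p ⊛ q′))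
  ⊛-distribˡ p q q′ = mk≋ λ k → begin
    coeff (p ⊛ (q ⊕ q′)) k
      ≈⟨ coeff-⊛ p (q ⊕ q′) k ⟩
    Σ< (suc k) (λ j → coeff p j * coeff (q ⊕ q′) (k ∸ j))
      ≈⟨ Σ<-cong (suc k) (λ j _ → trans (*-congˡ (coeff-⊕ q q′ (k ∸ j))) (distribˡ _ _ _)) ⟩
    Σ< (suc k) (λ j → coeff p j * coeff q (k ∸ j) + coeff p j * coeff q′ (k ∸ j))
      ≈⟨ Σ<-+ (suc k) _ _ ⟩
    _ + _
      ≈⟨ sym (+-cong (coeff-⊛ p q k) (coeff-⊛ p q′ k)) ⟩
    coeff (p ⊛ q) k + coeff (p ⊛ q′) k
      ≈⟨ sym (coeff-⊕ (p ⊛ q) (p ⊛ q′) k) ⟩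
    coeff ((p ⊛ q) ⊕ (p ⊛ q′)) k ∎

  ⊛-distribʳ : ∀ p p′ q → ((p ⊕ p′) ⊛ q) ≋ ((p ⊛ q) ⊕ (p′ ⊛ q))
  ⊛-distribʳ p p′ q = mk≋ λ k → begin
    coeff ((p ⊕ p′) ⊛ q) k
      ≈⟨ coeff-⊛ (p ⊕ p′) q k ⟩
    Σ< (suc k) (λ j → coeff (p ⊕ p′) j * coeff q (k ∸ j))
      ≈⟨ Σ<-cong (suc k) (λ j _ → trans (*-congʳ (coeff-⊕ p p′ j)) (distribʳ _ _ _)) ⟩
    Σ< (suc k) (λ j → coeff p j * coeff q (k ∸ j) + coeff p′ j * coeff q (k ∸ j))
      ≈⟨ Σ<-+ (suc k) _ _ ⟩
    _ + _
      ≈⟨ sym (+-cong (coeff-⊛ p q k) (coeff-⊛ p′ q k)) ⟩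
    coeff (p ⊛ q) k + coeff (p′ ⊛ q) k
      ≈⟨ sym (coeff-⊕ (p ⊛ q) (p′ ⊛ q) k) ⟩
    coeff ((p ⊛ q) ⊕ (p′ ⊛ q)) k ∎

  ⊛-scaleʳ : ∀ a p q → (p ⊛ scaleP a q) ≋ scaleP a (p ⊛ q)
  ⊛-scaleʳ a p q = mk≋ λ k → begin
    coeff (p ⊛ scaleP a q) k
      ≈⟨ coeff-⊛ p (scaleP a q) k ⟩
    Σ< (suc k) (λ j → coeff p j * coeff (scaleP a q) (k ∸ j))
      ≈⟨ Σ<-cong (suc k) (λ j _ → trans (*-congˡ (coeff-scale a q (k ∸ j))) (x∙yz≈y∙xz _ _ _)) ⟩
    Σ< (suc k) (λ j → a * (coeff p j * coeff q (k ∸ j)))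
      ≈⟨ Σ<-*ˡ (suc k) a _ ⟩
    a * _
      ≈⟨ *-congˡ (sym (coeff-⊛ p q k)) ⟩
    a * coeff (p ⊛ q) k
      ≈⟨ sym (coeff-scale a (p ⊛ q) k) ⟩
    coeff (scaleP a (p ⊛ q)) k ∎

  ⊛-scaleˡ : ∀ a p q → (scaleP a p ⊛ q) ≋ scaleP a (p ⊛ q)
  ⊛-scaleˡ a p q = mk≋ λ k → begin
    coeff (scaleP a p ⊛ q) k
      ≈⟨ coeff-⊛ (scaleP a p) q k ⟩
    Σ< (suc k) (λ j → coeff (scaleP a p) j * coeff q (k ∸ j))
      ≈⟨ Σ<-cong (suc k) (λ j _ → trans (*-congʳ (coeff-scale a p j)) (*-assoc _ _ _)) ⟩
    Σ< (suc k) (λ j → a * (coeff p j * coeff q (k ∸ j)))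
      ≈⟨ Σ<-*ˡ (suc k) a _ ⟩
    a * _
      ≈⟨ *-congˡ (sym (coeff-⊛ p q k)) ⟩
    a * coeff (p ⊛ q) k
      ≈⟨ sym (coeff-scale a (p ⊛ q) k) ⟩
    coeff (scaleP a (p ⊛ q)) k ∎

  ⊛-zeroʳ : ∀ p → (p ⊛ []) ≋ []
  ⊛-zeroʳ p = mk≋ λ k → trans (coeff-⊛ p [] k) (Σ<-zero (suc k) (λ j _ → zeroʳ _))

  shift-⊛ : ∀ p q → ((0# ∷ p) ⊛ q) ≋ (0# ∷ (p ⊛ q))
  shift-⊛ p q = mk≋ λ k → trans (coeff-⊕ (scaleP 0# q) (0# ∷ (p ⊛ q)) k)
    (trans (+-congʳ (trans (coeff-scale 0# q k) (zeroˡ _))) (+-identityˡ _))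

  ⊛-identityˡ : ∀ p → (constP 1# ⊛ p) ≋ p
  ⊛-identityˡ p = mk≋ λ k → trans (coeff-⊕ (scaleP 1# p) (0# ∷ []) k)
    (trans (+-cong (coeff-scale 1# p k) (zero-coeffs k)) (trans (+-identityʳ _) (*-identityˡ _)))
    where
    zero-coeffs : ∀ k → coeff (0# ∷ []) k ≈ 0#
    zero-coeffs zero    = refl
    zero-coeffs (suc k) = refl

  ⊛-consʳ : ∀ q a p → (q ⊛ (a ∷ p)) ≋ (scaleP a q ⊕ (0# ∷ (q ⊛ p)))
  ⊛-consʳ []      a p = mk≋ λ { zero → refl ; (suc k) → refl }
  ⊛-consʳ (b ∷ q) a p = mk≋ λ { zero → +-congʳ (*-comm b a) ; (suc k) → begin
    coeff (scaleP b p ⊕ (q ⊛ (a ∷ p))) k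
      ≈⟨ coeff-⊕ (scaleP b p) _ k ⟩
    coeff (scaleP b p) k + coeff (q ⊛ (a ∷ p)) k
      ≈⟨ +-congˡ (trans (get≋ (⊛-consʳ q a p) k) (coeff-⊕ (scaleP a q) _ k)) ⟩
    coeff (scaleP b p) k + (coeff (scaleP a q) k + coeff (0# ∷ (q ⊛ p)) k)
      ≈⟨ x+[y+z]≈y+[x+z] _ _ _ ⟩
    coeff (scaleP a q) k + (coeff (scaleP b p) k + coeff (0# ∷ (q ⊛ p)) k)
      ≈⟨ sym (trans (coeff-⊕ (scaleP a q) _ k) (+-congˡ (coeff-⊕ (scaleP b p) _ k))) ⟩
    coeff (scaleP a q ⊕ (scaleP b p ⊕ (0# ∷ (q ⊛ p)))) k ∎ }

  ⊛-comm : ∀ p q → (p ⊛ q) ≋ (q ⊛ p)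
  ⊛-comm []      q = ≋-sym (⊛-zeroʳ q)
  ⊛-comm (a ∷ p) q = ≋-trans (⊕-cong ≋-refl (∷-cong refl (⊛-comm p q))) (≋-sym (⊛-consʳ q a p))

  ⊛-assoc : ∀ p q r → ((p ⊛ q) ⊛ r) ≋ (p ⊛ (q ⊛ r))
  ⊛-assoc []      q r = ≋-refl
  ⊛-assoc (a ∷ p) q r = ≋-trans (⊛-distribʳ (scaleP a q) (0# ∷ (p ⊛ q)) r)
    (⊕-cong (⊛-scaleˡ a q r) (≋-trans (shift-⊛ (p ⊛ q) r) (∷-cong refl (⊛-assoc p q r))))

  powP-+ : ∀ q a b → (powP q a ⊛ powP q b) ≋ powP q (a +ℕ b)
  powP-+ q zero    b = ⊛-identityˡ (powP q b)
  powP-+ q (suc a) b = ≋-trans (⊛-assoc q (powP q a) (powP q b)) (⊛-congʳ q (powP-+ q a b))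

  X-⊛ : ∀ p → (X ⊛ p) ≋ (0# ∷ p)
  X-⊛ p = ≋-trans (shift-⊛ (constP 1#) p) (∷-cong refl (⊛-identityˡ p))

  onePlusX-⊛ : ∀ q → (onePlusX ⊛ q) ≋ (q ⊕ (0# ∷ q))
  onePlusX-⊛ q = ⊕-cong {scaleP 1# q} {q} (mk≋ λ k → trans (coeff-scale 1# q k) (*-identityˡ _))
                        (∷-cong refl (⊛-identityˡ q))

  record Deg (p : Poly) (N : ℕ) : Set ℓ where
    constructor mkDeg
    field getDeg : ∀ k → N < k → coeff p k ≈ 0#
  open Deg public

  Deg-mono : ∀ {p a b} → Deg p a → a ≤ b → Deg p b
  Deg-mono d a≤b = mkDeg λ k b<k → getDeg d k (ℕP.≤-<-trans a≤b b<k)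

  Deg-⊕ : ∀ {p q N} → Deg p N → Deg q N → Deg (p ⊕ q) N
  Deg-⊕ {p} {q} dp dq = mkDeg λ k N<k →
    trans (coeff-⊕ p q k) (trans (+-cong (getDeg dp k N<k) (getDeg dq k N<k)) (+-identityʳ 0#))

  Deg-scale : ∀ {a p N} → Deg p N → Deg (scaleP a p) N
  Deg-scale {a} {p} dp = mkDeg λ k N<k →
    trans (coeff-scale a p k) (trans (*-congˡ (getDeg dp k N<k)) (zeroʳ a))

  Deg-⊛ : ∀ {p q a b} → Deg p a → Deg q b → Deg (p ⊛ q) (a +ℕ b)
  Deg-⊛ {p} {q} {a} {b} dp dq = mkDeg λ k a+b<k →
    trans (coeff-⊛ p q k) (Σ<-zero (suc k) (vanishing-term k a+b<k))
    where
    -- in each term  p_j q_{k-j}  either j > a or k - j > b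
    vanishing-term : ∀ k → a +ℕ b < k → ∀ j → j < suc k → coeff p j * coeff q (k ∸ j) ≈ 0#
    vanishing-term k a+b<k j j≤k with ℕP.≤-<-connex j a
    ... | inj₂ a<j = trans (*-congʳ (getDeg dp j a<j)) (zeroˡ _)
    ... | inj₁ j≤a = trans (*-congˡ (getDeg dq (k ∸ j) b<k∸j)) (zeroʳ _)
      where
      b<k∸j : b < k ∸ j
      b<k∸j = ℕP.m+n≤o⇒m≤o∸n (suc b) (ℕP.≤-<-trans
        (ℕP.≤-trans (ℕP.+-monoʳ-≤ b j≤a) (ℕP.≤-reflexive (ℕP.+-comm b a))) a+b<k)

  Deg-const : ∀ a → Deg (constP a) 0
  Deg-const a = mkDeg λ { (suc k) _ → refl }

  Deg-lin : ∀ a b → Deg (a ∷ b ∷ []) 1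
  Deg-lin a b = mkDeg λ { (suc (suc k)) _ → refl ; (suc zero) (s≤s ()) }

  Deg-pow-lin : ∀ a b k → Deg (powP (a ∷ b ∷ []) k) k
  Deg-pow-lin a b zero    = Deg-const 1#
  Deg-pow-lin a b (suc k) = Deg-⊛ (Deg-lin a b) (Deg-pow-lin a b k)

  Deg-fallP : ∀ k → Deg (fallP k) k
  Deg-fallP zero    = Deg-const 1#
  Deg-fallP (suc k) = Deg-mono (Deg-⊛ (Deg-fallP k) (Deg-lin _ 1#)) (ℕP.≤-reflexive (ℕP.+-comm k 1))

  Deg-riseP : ∀ k → Deg (riseP k) k
  Deg-riseP zero    = Deg-const 1#
  Deg-riseP (suc k) = Deg-mono (Deg-⊛ (Deg-riseP k) (Deg-lin _ 1#)) (ℕP.≤-reflexive (ℕP.+-comm k 1))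

  coeff-tab< : ∀ N (H : ℕ → Carrier) k → k < N → coeff (tabulate {n = N} (λ m → H (toℕ m))) k ≡ H k
  coeff-tab< (suc N) H zero    _         = P.refl
  coeff-tab< (suc N) H (suc k) (s≤s k<N) = coeff-tab< N (λ j → H (suc j)) k k<N

  coeff-tab≥ : ∀ N (g : Fin N → Carrier) k → N ≤ k → coeff (tabulate g) k ≡ 0#
  coeff-tab≥ zero    g k       _         = P.refl
  coeff-tab≥ (suc N) g (suc k) (s≤s N≤k) = coeff-tab≥ N (λ i → g (Fin.suc i)) k N≤k

  tab-cong : ∀ N {H H′ : ℕ → Carrier} → (∀ m → H m ≈ H′ m) →
             tabulate {n = N} (λ m → H (toℕ m)) ≋ tabulate {n = N} (λ m → H′ (toℕ m))
  tab-cong zero    e = ≋-refl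
  tab-cong (suc N) e = ∷-cong (e 0) (tab-cong N (λ m → e (suc m)))

  tab-prefix : ∀ {N M} (H : ℕ → Carrier) → N ≤ M →
    tabulate {n = suc N} (λ m → H (toℕ m)) ≈[ N ] tabulate {n = suc M} (λ m → H (toℕ m))
  tab-prefix {N} {M} H N≤M = mk≈[] λ k k≤N → trans (reflexive (coeff-tab< (suc N) H k (s≤s k≤N)))
    (sym (reflexive (coeff-tab< (suc M) H k (s≤s (ℕP.≤-trans k≤N N≤M)))))

  Deg-tab : ∀ N (g : Fin (suc N) → Carrier) → Deg (tabulate g) N
  Deg-tab N g = mkDeg λ k N<k → reflexive (coeff-tab≥ (suc N) g k N<k)

  tab-scale : ∀ N a (H : ℕ → Carrier) →
              scaleP a (tabulate {n = N} (λ m → H (toℕ m))) ≋ tabulate {n = N} (λ m → a * H (toℕ m))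
  tab-scale zero    a H = ≋-refl
  tab-scale (suc N) a H = ∷-cong refl (tab-scale N a (λ j → H (suc j)))

  coeff-take< : ∀ m p k → k < m → coeff (take m p) k ≡ coeff p k
  coeff-take< (suc m) []      k       _         = P.refl
  coeff-take< (suc m) (a ∷ p) zero    _         = P.refl
  coeff-take< (suc m) (a ∷ p) (suc k) (s≤s k<m) = coeff-take< m p k k<m

  coeff-take≥ : ∀ m p k → m ≤ k → coeff (take m p) k ≡ 0#
  coeff-take≥ zero    p       k       _         = P.refl
  coeff-take≥ (suc m) []      k       _         = P.refl
  coeff-take≥ (suc m) (a ∷ p) (suc k) (s≤s m≤k) = coeff-take≥ m p k m≤k

  ΣP : ∀ {a} {I : Set a} → List I → (I → Poly) → Poly
  ΣP xs h = foldr _⊕_ [] (map h xs)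

  coeff-ΣP : ∀ {a} {I : Set a} (xs : List I) h k → coeff (ΣP xs h) k ≈ ΣL xs (λ x → coeff (h x) k)
  coeff-ΣP []       h k = refl
  coeff-ΣP (x ∷ xs) h k = trans (coeff-⊕ (h x) _ k) (+-congˡ (coeff-ΣP xs h k))

  ΣP-cong : ∀ {a} {I : Set a} (xs : List I) {h h′ : I → Poly} → (∀ x → h x ≋ h′ x) → ΣP xs h ≋ ΣP xs h′
  ΣP-cong []       e = ≋-refl
  ΣP-cong (x ∷ xs) e = ⊕-cong (e x) (ΣP-cong xs e)

  ΣP-cong-≈[] : ∀ {a} {I : Set a} (xs : List I) {h h′ N} → (∀ x → h x ≈[ N ] h′ x) → ΣP xs h ≈[ N ] ΣP xs h′
  ΣP-cong-≈[] xs {h} {h′} e = mk≈[] λ k k≤ →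
    trans (coeff-ΣP xs h k) (trans (ΣL-cong xs (λ x → get≈[] (e x) k k≤)) (sym (coeff-ΣP xs h′ k)))

  ⊛-ΣP : ∀ {a} {I : Set a} (xs : List I) q h → (q ⊛ ΣP xs h) ≋ ΣP xs (λ x → q ⊛ h x)
  ⊛-ΣP []       q h = ⊛-zeroʳ q
  ⊛-ΣP (x ∷ xs) q h = ≋-trans (⊛-distribˡ q (h x) _) (⊕-cong ≋-refl (⊛-ΣP xs q h))

  Deg-ΣP : ∀ {a} {I : Set a} (xs : List I) {h N} → (∀ x → Deg (h x) N) → Deg (ΣP xs h) N
  Deg-ΣP []       d = mkDeg λ k _ → refl
  Deg-ΣP (x ∷ xs) d = Deg-⊕ (d x) (Deg-ΣP xs d)

  -- The pairing of a polynomial with a weight sequence w: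
  -- pairing w p = Σ_k p_k · w k.  Evaluation at y is the pairing with
  -- the powers of y; pairing with binomial weights is used below.
  pairing : (ℕ → Carrier) → Poly → Carrier
  pairing w []      = 0#
  pairing w (a ∷ p) = a * w 0 + pairing (λ s → w (suc s)) p

  pairing-⊕ : ∀ w p q → pairing w (p ⊕ q) ≈ pairing w p + pairing w q
  pairing-⊕ w []      q       = sym (+-identityˡ _)
  pairing-⊕ w (a ∷ p) []      = sym (+-identityʳ _)
  pairing-⊕ w (a ∷ p) (b ∷ q) = trans (+-cong (distribʳ _ _ _) (pairing-⊕ (λ s → w (suc s)) p q))
    (+-interchange _ _ _ _)

  pairing-scale : ∀ w a p → pairing w (scaleP a p) ≈ a * pairing w p
  pairing-scale w a []      = sym (zeroʳ a)
  pairing-scale w a (b ∷ p) = trans (+-cong (*-assoc _ _ _) (pairing-scale _ a p)) (sym (distribˡ _ _ _))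

  pairing-zero : ∀ w p → (∀ k → coeff p k ≈ 0#) → pairing w p ≈ 0#
  pairing-zero w []      z = refl
  pairing-zero w (a ∷ p) z = trans
    (+-cong (trans (*-congʳ (z 0)) (zeroˡ _)) (pairing-zero (λ s → w (suc s)) p (λ k → z (suc k))))
    (+-identityʳ 0#)

  pairing-cong : ∀ w {p q} → p ≋ q → pairing w p ≈ pairing w q
  pairing-cong w {[]}    {q}     e = sym (pairing-zero w q (λ k → sym (get≋ e k)))
  pairing-cong w {a ∷ p} {[]}    e = pairing-zero w (a ∷ p) (get≋ e)
  pairing-cong w {a ∷ p} {b ∷ q} e =
    +-cong (*-congʳ (get≋ e 0)) (pairing-cong (λ s → w (suc s)) {p} {q} (mk≋ λ k → get≋ e (suc k)))

  pairing-congʷ : ∀ {w w′} p → (∀ s → w s ≈ w′ s) → pairing w p ≈ pairing w′ p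
  pairing-congʷ []      e = refl
  pairing-congʷ (a ∷ p) e = +-cong (*-congˡ (e 0)) (pairing-congʷ p (λ s → e (suc s)))

  pairing-+ʷ : ∀ w w′ p → pairing (λ s → w s + w′ s) p ≈ pairing w p + pairing w′ p
  pairing-+ʷ w w′ []      = sym (+-identityʳ 0#)
  pairing-+ʷ w w′ (a ∷ p) = trans (+-cong (distribˡ _ _ _) (pairing-+ʷ _ _ p))
    (+-interchange _ _ _ _)

  pairing-*ʷ : ∀ w b p → pairing (λ s → b * w s) p ≈ b * pairing w p
  pairing-*ʷ w b []      = sym (zeroʳ b)
  pairing-*ʷ w b (a ∷ p) = trans (+-cong (x∙yz≈y∙xz _ _ _) (pairing-*ʷ _ b p)) (sym (distribˡ _ _ _))

  pairing-Deg : ∀ N w p → Deg p N → Σ< (suc N) (λ s → coeff p s * w s) ≈ pairing w p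
  pairing-Deg N       w []      d = Σ<-zero (suc N) (λ j _ → zeroˡ _)
  pairing-Deg zero    w (a ∷ p) d = trans (reflexive (Σ<-suc 0 _)) (+-congˡ
    (trans (reflexive (Σ<-0 _)) (sym (pairing-zero _ p (λ k → getDeg d (suc k) (s≤s z≤n))))))
  pairing-Deg (suc N) w (a ∷ p) d = trans (reflexive (Σ<-suc (suc N) _)) (+-congˡ
    (pairing-Deg N _ p (mkDeg λ k N<k → getDeg d (suc k) (s≤s N<k))))

  pairing-ΣP : ∀ {a} {I : Set a} w (xs : List I) h → pairing w (ΣP xs h) ≈ ΣL xs (λ x → pairing w (h x))
  pairing-ΣP w []       h = refl
  pairing-ΣP w (x ∷ xs) h = trans (pairing-⊕ w (h x) _) (+-congˡ (pairing-ΣP w xs h))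

  pairing-tab : ∀ N w (H : ℕ → Carrier) →
                pairing w (tabulate {n = N} (λ m → H (toℕ m))) ≈ Σ< N (λ t → H t * w t)
  pairing-tab zero    w H = sym (reflexive (Σ<-0 _))
  pairing-tab (suc N) w H = trans (+-congˡ (pairing-tab N _ _)) (sym (reflexive (Σ<-suc N _)))

  pairing-X^ : ∀ w r → pairing w (powP X r) ≈ w r
  pairing-X^ w zero    = trans (+-identityʳ _) (*-identityˡ _)
  pairing-X^ w (suc r) = trans (pairing-cong w (X-⊛ (powP X r)))
    (trans (+-cong (zeroˡ _) (pairing-X^ _ r)) (+-identityˡ _))

  eval : Poly → Carrier → Carrier
  eval p y = pairing (powR y) p

  eval-∷ : ∀ a p y → eval (a ∷ p) y ≈ a + y * eval p y
  eval-∷ a p y = +-cong (*-identityʳ a) (pairing-*ʷ (powR y) y p)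

  eval-⊛ : ∀ p q y → eval (p ⊛ q) y ≈ eval p y * eval q y
  eval-⊛ []      q y = sym (zeroˡ _)
  eval-⊛ (a ∷ p) q y = begin
    eval (scaleP a q ⊕ (0# ∷ (p ⊛ q))) y
      ≈⟨ pairing-⊕ (powR y) (scaleP a q) _ ⟩
    eval (scaleP a q) y + eval (0# ∷ (p ⊛ q)) y
      ≈⟨ +-cong (pairing-scale _ a q) (trans (eval-∷ 0# (p ⊛ q) y) (+-congˡ (*-congˡ (eval-⊛ p q y)))) ⟩
    a * eval q y + (0# + y * (eval p y * eval q y))
      ≈⟨ solve 4 (λ a′ e f y′ → a′ :* e :+ (con (ℤ.+ 0) :+ y′ :* (f :* e)) := (a′ :+ y′ :* f) :* e)
           refl _ _ _ _ ⟩
    (a + y * eval p y) * eval q y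
      ≈⟨ *-congʳ (sym (eval-∷ a p y)) ⟩
    eval (a ∷ p) y * eval q y ∎

  eval-const : ∀ a y → eval (constP a) y ≈ a
  eval-const a y = trans (+-identityʳ _) (*-identityʳ _)

  eval-lin : ∀ a b y → eval (a ∷ b ∷ []) y ≈ a + b * y
  eval-lin a b y = trans (eval-∷ a (b ∷ []) y)
    (+-congˡ (trans (*-congˡ (trans (eval-∷ b [] y) (trans (+-congˡ (zeroʳ y)) (+-identityʳ b)))) (*-comm y b)))

  eval-shiftPow : ∀ a y q → eval (powP (a ∷ 1# ∷ []) q) y ≈ powR (a + y) q
  eval-shiftPow a y zero    = eval-const 1# y
  eval-shiftPow a y (suc q) = trans (eval-⊛ (a ∷ 1# ∷ []) (powP (a ∷ 1# ∷ []) q) y)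
    (*-cong (trans (eval-lin a 1# y) (+-congˡ (*-identityˡ y))) (eval-shiftPow a y q))

module Binomials {c ℓ} (R : CommutativeRing c ℓ) (inv : ℕ → CommutativeRing.Carrier R)
  (inv-correct : ∀ k → CommutativeRing._≈_ R (CommutativeRing._*_ R (Ops.fromℕ R inv (suc k)) (inv k))
                                              (CommutativeRing.1# R)) where
  open CommutativeRing R
  open Ops R inv
  open Polynomials R inv public

  fallR-cong : ∀ {a b} k → a ≈ b → fallR a k ≈ fallR b k
  fallR-cong zero    e = refl
  fallR-cong (suc k) e = *-cong (fallR-cong k e) (+-congʳ e)

  binom-cong : ∀ {a b} k → a ≈ b → binom a k ≈ binom b k
  binom-cong k e = *-congʳ (fallR-cong k e)

  fallR-suc : ∀ w N → fallR w (suc N) ≈ w * fallR (w - 1#) N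
  fallR-suc w zero    = trans (*-identityˡ _) (solve 1 (λ w′ → w′ :- con (ℤ.+ 0) := w′ :* con (ℤ.+ 1)) refl w)
  fallR-suc w (suc N) = begin
    fallR w (suc N) * (w - fromℕ (suc N))              ≈⟨ *-congʳ (fallR-suc w N) ⟩
    (w * fallR (w - 1#) N) * (w - (1# + fromℕ N))
      ≈⟨ solve 3 (λ w′ F K → (w′ :* F) :* (w′ :- (con (ℤ.+ 1) :+ K))
                             := w′ :* (F :* ((w′ :- con (ℤ.+ 1)) :- K))) refl _ _ _ ⟩
    w * (fallR (w - 1#) N * ((w - 1#) - fromℕ N))     ∎

  -- Pascal's rule; this is where  (k+1)·inv k = 1  is used
  pascal : ∀ z k → binom (z + 1#) (suc k) ≈ binom z (suc k) + binom z k
  pascal z k = begin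
    fallR (z + 1#) (suc k) * (u * I)
      ≈⟨ *-congʳ (trans (fallR-suc (z + 1#) k)
           (*-congˡ (fallR-cong k (solve 1 (λ z′ → (z′ :+ con (ℤ.+ 1)) :- con (ℤ.+ 1) := z′) refl z)))) ⟩
    ((z + 1#) * F) * (u * I)
      ≈⟨ solve 5 (λ z′ F′ K u′ I′ → (z′ :+ con (ℤ.+ 1)) :* F′ :* (u′ :* I′) :=
                   F′ :* (z′ :- K) :* (u′ :* I′) :+ F′ :* I′ :* ((con (ℤ.+ 1) :+ K) :* u′)) refl z F K u I ⟩
    (F * (z - K)) * (u * I) + (F * I) * ((1# + K) * u)
      ≈⟨ +-congˡ (trans (*-congˡ (inv-correct k)) (*-identityʳ _)) ⟩
    (F * (z - K)) * (u * I) + F * I ∎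
    where
    F = fallR z k
    K = fromℕ k
    u = inv k
    I = invFact k

  vandermonde : ∀ A m s → Σ< (suc s) (λ t → binom A (s ∸ t) * fromℕ (choose m t)) ≈ binom (A + fromℕ m) s
  vandermonde A zero s = begin
    Σ< (suc s) (λ t → binom A (s ∸ t) * fromℕ (choose 0 t))
      ≈⟨ reflexive (Σ<-suc s _) ⟩
    binom A s * fromℕ 1 + Σ< s (λ t → binom A (s ∸ suc t) * 0#)
      ≈⟨ +-cong (trans (*-congˡ (+-identityʳ 1#)) (*-identityʳ _)) (Σ<-zero s (λ j _ → zeroʳ _)) ⟩
    binom A s + 0#
      ≈⟨ +-identityʳ _ ⟩
    binom A s
      ≈⟨ binom-cong s (sym (+-identityʳ A)) ⟩
    binom (A + 0#) s ∎
  vandermonde A (suc m) zero = trans (reflexive (Σ<-suc 0 _)) (trans (+-congˡ (reflexive (Σ<-0 _)))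
    (trans (+-identityʳ _) (trans (*-congˡ (+-identityʳ 1#)) (*-identityʳ _))))
  vandermonde A (suc m) (suc s) = begin
    Σ< (suc (suc s)) (λ t → b (suc s ∸ t) * fromℕ (choose (suc m) t))
      ≈⟨ reflexive (Σ<-suc (suc s) _) ⟩
    b (suc s) * fromℕ 1 + Σ< (suc s) (λ t → b (s ∸ t) * fromℕ (choose m t +ℕ choose m (suc t)))
      ≈⟨ +-congˡ (trans (Σ<-cong (suc s) (λ t _ → trans (*-congˡ (fromℕ-+ (choose m t) _)) (distribˡ _ _ _)))
                        (Σ<-+ (suc s) (λ t → b (s ∸ t) * fromℕ (choose m t)) _)) ⟩
    b (suc s) * fromℕ 1 + (S₀ + S₁)
      ≈⟨ x+[y+z]≈y+[x+z] _ _ _ ⟩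
    S₀ + (b (suc s) * fromℕ 1 + S₁)
      ≡⟨ P.cong (λ k → S₀ + (b (suc s) * fromℕ k + S₁)) (P.sym (choose-0 m)) ⟩
    S₀ + (b (suc s) * fromℕ (choose m 0) + S₁)
      ≈⟨ +-congˡ (sym (reflexive (Σ<-suc (suc s) _))) ⟩
    S₀ + Σ< (suc (suc s)) (λ t → b (suc s ∸ t) * fromℕ (choose m t))
      ≈⟨ +-cong (vandermonde A m s) (vandermonde A m (suc s)) ⟩
    binom (A + fromℕ m) s + binom (A + fromℕ m) (suc s)
      ≈⟨ trans (+-comm _ _) (sym (pascal (A + fromℕ m) s)) ⟩
    binom ((A + fromℕ m) + 1#) (suc s)
      ≈⟨ binom-cong (suc s) (solve 2 (λ a′ m′ → (a′ :+ m′) :+ con (ℤ.+ 1) := a′ :+ (con (ℤ.+ 1) :+ m′))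
                                     refl A (fromℕ m)) ⟩
    binom (A + fromℕ (suc m)) (suc s) ∎
    where
    b = binom A
    S₀ = Σ< (suc s) (λ t → b (s ∸ t) * fromℕ (choose m t))
    S₁ = Σ< (suc s) (λ t → b (s ∸ t) * fromℕ (choose m (suc t)))

  B-image : Carrier → ℕ → Poly
  B-image A s = tabulate {n = suc s} (λ i → binom A (s ∸ toℕ i))

  pairing-B-image : ∀ A m s → pairing (λ t → fromℕ (choose m t)) (B-image A s) ≈ binom (A + fromℕ m) s
  pairing-B-image A m s = trans (pairing-tab (suc s) _ (λ t → binom A (s ∸ t))) (vandermonde A m s)

  binomFrom : Carrier → ℕ → ℕ → Carrier
  binomFrom z j s = binom z (j +ℕ s)

  -- multiplying by (1+x) is adjoint, under Pascal's rule, to raising z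
  -- and the starting index by one
  pairing-onePlusX : ∀ z j q → pairing (binomFrom z j) (onePlusX ⊛ q) ≈ pairing (binomFrom (z + 1#) (suc j)) q
  pairing-onePlusX z j q = begin
    pairing (binomFrom z j) (onePlusX ⊛ q)
      ≈⟨ pairing-cong (binomFrom z j) (onePlusX-⊛ q) ⟩
    pairing (binomFrom z j) (q ⊕ (0# ∷ q))
      ≈⟨ pairing-⊕ (binomFrom z j) q (0# ∷ q) ⟩
    pairing (binomFrom z j) q + (0# * binomFrom z j 0 + pairing (λ s → binomFrom z j (suc s)) q)
      ≈⟨ +-congˡ (trans (+-congʳ (zeroˡ _)) (+-identityˡ _)) ⟩
    pairing (binomFrom z j) q + pairing (λ s → binomFrom z j (suc s)) q
      ≈⟨ +-congˡ (pairing-congʷ q (λ s → reflexive (P.cong (binom z) (ℕP.+-suc j s)))) ⟩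
    pairing (binomFrom z j) q + pairing (binomFrom z (suc j)) q
      ≈⟨ sym (pairing-+ʷ (binomFrom z j) (binomFrom z (suc j)) q) ⟩
    pairing (λ s → binomFrom z j s + binomFrom z (suc j) s) q
      ≈⟨ pairing-congʷ q (λ s → trans (+-comm _ _) (sym (pascal z (j +ℕ s)))) ⟩
    pairing (binomFrom (z + 1#) (suc j)) q ∎

  pairing-onePlusX^ : ∀ z j k q →
    pairing (binomFrom z j) (powP onePlusX k ⊛ q) ≈ pairing (binomFrom (z + fromℕ k) (k +ℕ j)) q
  pairing-onePlusX^ z j zero q = trans (pairing-cong (binomFrom z j) (⊛-identityˡ q))
    (pairing-congʷ q (λ s → binom-cong (j +ℕ s) (sym (+-identityʳ z))))
  pairing-onePlusX^ z j (suc k) q = begin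
    pairing (binomFrom z j) ((onePlusX ⊛ powP onePlusX k) ⊛ q)
      ≈⟨ pairing-cong (binomFrom z j) (⊛-assoc onePlusX (powP onePlusX k) q) ⟩
    pairing (binomFrom z j) (onePlusX ⊛ (powP onePlusX k ⊛ q))
      ≈⟨ pairing-onePlusX z j (powP onePlusX k ⊛ q) ⟩
    pairing (binomFrom (z + 1#) (suc j)) (powP onePlusX k ⊛ q)
      ≈⟨ pairing-onePlusX^ (z + 1#) (suc j) k q ⟩
    pairing (binomFrom ((z + 1#) + fromℕ k) (k +ℕ suc j)) q
      ≈⟨ pairing-congʷ q (λ s → trans (reflexive (P.cong (λ i → binom ((z + 1#) + fromℕ k) (i +ℕ s)) (ℕP.+-suc k j)))
           (binom-cong (suc (k +ℕ j) +ℕ s)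
              (solve 2 (λ z′ K → (z′ :+ con (ℤ.+ 1)) :+ K := z′ :+ (con (ℤ.+ 1) :+ K)) refl z (fromℕ k)))) ⟩
    pairing (binomFrom (z + fromℕ (suc k)) (suc k +ℕ j)) q ∎

  pairing-V-image : ∀ z k r → pairing (binom z) (powP onePlusX k ⊛ powP X r) ≈ binom (z + fromℕ k) ((k +ℕ 0) +ℕ r)
  pairing-V-image z k r = trans (pairing-onePlusX^ z 0 k (powP X r)) (pairing-X^ _ r)

  eval-fall-rise : ∀ z r s → eval (fallP r ⊛ riseP s) z ≈ fallR (z + fromℕ s) (r +ℕ s)
  eval-fall-rise z r zero = begin
    eval (fallP r ⊛ constP 1#) z         ≈⟨ trans (eval-⊛ (fallP r) _ z) (*-congˡ (eval-const 1# z)) ⟩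
    eval (fallP r) z * 1#                ≈⟨ trans (*-identityʳ _) (eval-fallP r) ⟩
    fallR z r                            ≈⟨ fallR-cong r (sym (+-identityʳ z)) ⟩
    fallR (z + 0#) r                     ≡⟨ P.cong (fallR (z + 0#)) (P.sym (ℕP.+-identityʳ r)) ⟩
    fallR (z + 0#) (r +ℕ 0)              ∎
    where
    eval-fallP : ∀ r → eval (fallP r) z ≈ fallR z r
    eval-fallP zero    = eval-const 1# z
    eval-fallP (suc r) = trans (eval-⊛ (fallP r) _ z)
      (*-cong (eval-fallP r) (trans (eval-lin _ 1# z) (trans (+-congˡ (*-identityˡ z)) (+-comm _ _))))
  eval-fall-rise z r (suc s) = begin
    eval (fallP r ⊛ (riseP s ⊛ lin)) z
      ≈⟨ trans (eval-⊛ (fallP r) _ z) (*-congˡ (eval-⊛ (riseP s) lin z)) ⟩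
    eval (fallP r) z * (eval (riseP s) z * eval lin z)
      ≈⟨ trans (sym (*-assoc _ _ _)) (*-congʳ (sym (eval-⊛ (fallP r) _ z))) ⟩
    eval (fallP r ⊛ riseP s) z * eval lin z
      ≈⟨ *-cong (eval-fall-rise z r s) (trans (eval-lin _ 1# z) (+-congˡ (*-identityˡ z))) ⟩
    fallR (z + fromℕ s) (r +ℕ s) * ((1# + fromℕ s) + z)
      ≈⟨ trans (*-comm _ _) (*-cong
           (solve 2 (λ S z′ → (con (ℤ.+ 1) :+ S) :+ z′ := z′ :+ (con (ℤ.+ 1) :+ S)) refl (fromℕ s) z)
           (fallR-cong (r +ℕ s)
             (solve 2 (λ S z′ → z′ :+ S := (z′ :+ (con (ℤ.+ 1) :+ S)) :- con (ℤ.+ 1)) refl (fromℕ s) z))) ⟩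
    W * fallR (W - 1#) (r +ℕ s)
      ≈⟨ sym (fallR-suc W (r +ℕ s)) ⟩
    fallR W (suc (r +ℕ s))
      ≡⟨ P.cong (fallR W) (P.sym (ℕP.+-suc r s)) ⟩
    fallR W (r +ℕ suc s) ∎
    where
    lin = fromℕ (suc s) ∷ 1# ∷ []
    W = z + fromℕ (suc s)

  -- The bridge between the two sides: for r ≤ n,
  --   ⟨ C(z,·) , V_n x^r ⟩ = (1/n!) · (U_n^{-1} x^r)(z).
  V-image≈Uinv-image : ∀ n r → r ≤ n → ∀ z →
    pairing (binom z) (powP onePlusX (n ∸ r) ⊛ powP X r) ≈ invFact n * eval (fallP r ⊛ riseP (n ∸ r)) z
  V-image≈Uinv-image n r r≤n z = begin
    pairing (binom z) (powP onePlusX (n ∸ r) ⊛ powP X r)   ≈⟨ pairing-V-image z (n ∸ r) r ⟩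
    binom (z + fromℕ (n ∸ r)) (((n ∸ r) +ℕ 0) +ℕ r)       ≡⟨ P.cong (binom (z + fromℕ (n ∸ r))) n-r+0+r≡n ⟩
    fallR (z + fromℕ (n ∸ r)) n * invFact n               ≈⟨ *-comm _ _ ⟩
    invFact n * fallR (z + fromℕ (n ∸ r)) n               ≡⟨ P.cong (λ k → invFact n * fallR (z + fromℕ (n ∸ r)) k) (P.sym r+n-r≡n) ⟩
    invFact n * fallR (z + fromℕ (n ∸ r)) (r +ℕ (n ∸ r)) ≈⟨ *-congˡ (sym (eval-fall-rise z r (n ∸ r))) ⟩
    invFact n * eval (fallP r ⊛ riseP (n ∸ r)) z          ∎
    where
    r+n-r≡n : r +ℕ (n ∸ r) ≡ n
    r+n-r≡n = ℕP.m+[n∸m]≡n r≤n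
    n-r+0+r≡n : ((n ∸ r) +ℕ 0) +ℕ r ≡ n
    n-r+0+r≡n = P.trans (P.cong (_+ℕ r) (ℕP.+-identityʳ (n ∸ r))) (ℕP.m∸n+n≡m r≤n)

-- Truncated power series identities in degrees ≤ n:
--   (1-x)^{t+1} · Σ_m C(m,t) x^m = x^t               (binomial series)
--   (1-x)^{n-p} · A_p = (1-x)^{n+1} · Σ_m m^p x^m     (Euler polynomials)
-- The second follows from the first through Newton's expansion of m^p.
module Series {c ℓ} (R : CommutativeRing c ℓ) (inv : ℕ → CommutativeRing.Carrier R)
  (inv-correct : ∀ k → CommutativeRing._≈_ R (CommutativeRing._*_ R (Ops.fromℕ R inv (suc k)) (inv k))
                                              (CommutativeRing.1# R)) where
  open CommutativeRing R
  open Ops R inv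
  open Binomials R inv inv-correct public

  fromℕ-^ : ∀ m p → powR (fromℕ m) p ≈ fromℕ (m ^ℕ p)
  fromℕ-^ m zero    = sym (+-identityʳ 1#)
  fromℕ-^ m (suc p) = trans (*-congˡ (fromℕ-^ m p)) (sym (fromℕ-* m (m ^ℕ p)))

  fromℕ-ΣN : ∀ N h → fromℕ (ΣN N h) ≈ Σ< N (λ t → fromℕ (h t))
  fromℕ-ΣN zero    h = sym (reflexive (Σ<-0 _))
  fromℕ-ΣN (suc N) h = trans (fromℕ-+ (h 0) _)
    (trans (+-congˡ (fromℕ-ΣN N (λ j → h (suc j)))) (sym (reflexive (Σ<-suc N _))))

  newton-R : ∀ m p → powR (fromℕ m) p ≈ Σ< (suc p) (λ t → fromℕ (surj p t) * fromℕ (choose m t))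
  newton-R m p = begin
    powR (fromℕ m) p                                        ≈⟨ fromℕ-^ m p ⟩
    fromℕ (m ^ℕ p)                                          ≡⟨ P.cong fromℕ (newton p m) ⟩
    fromℕ (ΣN (suc p) (λ t → surj p t *ℕ choose m t))       ≈⟨ fromℕ-ΣN (suc p) (λ t → surj p t *ℕ choose m t) ⟩
    Σ< (suc p) (λ t → fromℕ (surj p t *ℕ choose m t))       ≈⟨ Σ<-cong (suc p) (λ t _ → fromℕ-* (surj p t) (choose m t)) ⟩
    Σ< (suc p) (λ t → fromℕ (surj p t) * fromℕ (choose m t)) ∎

  oneMinusX^ : ℕ → Poly
  oneMinusX^ k = powP oneMinusX k

  binomSeries : ℕ → ℕ → Poly
  binomSeries n t = tabulate {n = suc n} (λ m → fromℕ (choose (toℕ m) t))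

  powerSeries : ℕ → ℕ → Poly
  powerSeries n p = tabulate {n = suc n} (λ m → powR (fromℕ (toℕ m)) p)

  coeff-oneMinusX-⊛ : ∀ q k → coeff (oneMinusX ⊛ q) (suc k) ≈ coeff q (suc k) - coeff q k
  coeff-oneMinusX-⊛ q k = begin
    coeff (oneMinusX ⊛ q) (suc k)
      ≈⟨ trans (coeff-⊛ oneMinusX q (suc k)) (reflexive (Σ<-suc (suc k) _)) ⟩
    1# * coeff q (suc k) + Σ< (suc k) (λ j → coeff (- 1# ∷ []) j * coeff q (k ∸ j))
      ≈⟨ +-congˡ (trans (reflexive (Σ<-suc k _)) (+-congˡ (Σ<-zero k (λ j _ → zeroˡ _)))) ⟩
    1# * coeff q (suc k) + (- 1# * coeff q k + 0#)
      ≈⟨ solve 2 (λ a b → con (ℤ.+ 1) :* a :+ (:- con (ℤ.+ 1) :* b :+ con (ℤ.+ 0)) := a :- b) refl _ _ ⟩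
    coeff q (suc k) - coeff q k ∎

  coeff₀-oneMinusX-⊛ : ∀ q → coeff (oneMinusX ⊛ q) 0 ≈ coeff q 0
  coeff₀-oneMinusX-⊛ q = trans (coeff-⊛ oneMinusX q 0)
    (trans (reflexive (Σ<-suc 0 _)) (trans (+-congˡ (reflexive (Σ<-0 _))) (trans (+-identityʳ _) (*-identityˡ _))))

  oneMinusX-binomSeries : ∀ n t → (oneMinusX ⊛ binomSeries n (suc t)) ≈[ n ] (0# ∷ binomSeries n t)
  oneMinusX-binomSeries n t = mk≈[] λ
    { zero    _   → coeff₀-oneMinusX-⊛ (binomSeries n (suc t))
    ; (suc k) k<n → begin
      coeff (oneMinusX ⊛ binomSeries n (suc t)) (suc k)
        ≈⟨ coeff-oneMinusX-⊛ (binomSeries n (suc t)) k ⟩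
      coeff (binomSeries n (suc t)) (suc k) - coeff (binomSeries n (suc t)) k
        ≡⟨ P.cong₂ _-_ (coeff-tab< (suc n) (λ m → fromℕ (choose m (suc t))) (suc k) (s≤s k<n))
                       (coeff-tab< (suc n) (λ m → fromℕ (choose m (suc t))) k (ℕP.m≤n⇒m≤1+n k<n)) ⟩
      fromℕ (choose k t +ℕ choose k (suc t)) - fromℕ (choose k (suc t))
        ≈⟨ +-congʳ (fromℕ-+ (choose k t) _) ⟩
      (fromℕ (choose k t) + fromℕ (choose k (suc t))) - fromℕ (choose k (suc t))
        ≈⟨ solve 2 (λ a b → (a :+ b) :- b := a) refl _ _ ⟩
      fromℕ (choose k t)
        ≡⟨ P.sym (coeff-tab< (suc n) (λ m → fromℕ (choose m t)) k (ℕP.m≤n⇒m≤1+n k<n)) ⟩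
      coeff (binomSeries n t) k ∎ }

  oneMinusX-geometric : ∀ n → (oneMinusX ⊛ binomSeries n 0) ≈[ n ] constP 1#
  oneMinusX-geometric n = mk≈[] λ
    { zero    _   → trans (coeff₀-oneMinusX-⊛ (binomSeries n 0)) (+-identityʳ 1#)
    ; (suc k) k<n → trans (coeff-oneMinusX-⊛ (binomSeries n 0) k) (trans
        (+-cong (reflexive (coeff-tab< (suc n) (λ m → fromℕ (choose m 0)) (suc k) (s≤s k<n)))
                (-‿cong (reflexive (P.trans (coeff-tab< (suc n) (λ m → fromℕ (choose m 0)) k (ℕP.m≤n⇒m≤1+n k<n))
                                            (P.cong fromℕ (choose-0 k))))))
        (-‿inverseʳ _)) }

  oneMinusX^-suc : ∀ t → oneMinusX^ (suc t) ≋ (oneMinusX^ t ⊛ oneMinusX)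
  oneMinusX^-suc t = ⊛-comm oneMinusX (oneMinusX^ t)

  binomSeries-inverse : ∀ n t → (oneMinusX^ (suc t) ⊛ binomSeries n t) ≈[ n ] powP X t
  binomSeries-inverse n zero = ≈[]-trans
    (≋⇒≈[] (⊛-congˡ (binomSeries n 0) (≋-trans (oneMinusX^-suc 0) (⊛-identityˡ oneMinusX))))
    (oneMinusX-geometric n)
  binomSeries-inverse n (suc t) =
    ≈[]-trans (≋⇒≈[] (≋-trans (⊛-congˡ (binomSeries n (suc t)) (oneMinusX^-suc (suc t)))
                              (⊛-assoc (oneMinusX^ (suc t)) oneMinusX (binomSeries n (suc t)))))
    (≈[]-trans (⊛-congʳ-≈[] (oneMinusX^ (suc t)) (oneMinusX-binomSeries n t))
    (≈[]-trans (≋⇒≈[] (≋-trans (⊛-comm (oneMinusX^ (suc t)) (0# ∷ binomSeries n t))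
                              (≋-trans (shift-⊛ (binomSeries n t) (oneMinusX^ (suc t)))
                                       (∷-cong refl (⊛-comm (binomSeries n t) (oneMinusX^ (suc t)))))))
    (mk≈[] λ { zero _ → sym (get≋ (X-⊛ (powP X t)) 0)
             ; (suc k) k<n → trans (get≈[] (binomSeries-inverse n t) k (ℕP.<⇒≤ k<n))
                                   (sym (get≋ (X-⊛ (powP X t)) (suc k))) })))

  oneMinusX^-split : ∀ q t → t ≤ q → oneMinusX^ (suc q) ≋ (oneMinusX^ (q ∸ t) ⊛ oneMinusX^ (suc t))
  oneMinusX^-split q t t≤q =
    ≋-sym (P.subst (λ k → (oneMinusX^ (q ∸ t) ⊛ oneMinusX^ (suc t)) ≋ oneMinusX^ k) q-t+t+1≡q+1
                   (powP-+ oneMinusX (q ∸ t) (suc t)))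
    where
    q-t+t+1≡q+1 : (q ∸ t) +ℕ suc t ≡ suc q
    q-t+t+1≡q+1 = P.trans (ℕP.+-suc (q ∸ t) t) (P.cong suc (ℕP.m∸n+n≡m t≤q))

  binomSeries-times : ∀ n q t → t ≤ q →
    (oneMinusX^ (suc q) ⊛ binomSeries n t) ≈[ n ] (oneMinusX^ (q ∸ t) ⊛ powP X t)
  binomSeries-times n q t t≤q = ≈[]-trans
    (≋⇒≈[] (≋-trans (⊛-congˡ (binomSeries n t) (oneMinusX^-split q t t≤q))
                    (⊛-assoc (oneMinusX^ (q ∸ t)) (oneMinusX^ (suc t)) (binomSeries n t))))
    (⊛-congʳ-≈[] (oneMinusX^ (q ∸ t)) (binomSeries-inverse n t))

  record ∃Deg≤ (d : ℕ) (q : Poly) (n : ℕ) : Set (c ⊔ ℓ) where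
    field
      poly    : Poly
      deg     : Deg poly d
      agrees  : q ≈[ n ] poly

  powerSeries-newton : ∀ n p → powerSeries n p ≈[ n ]
    ΣP (allFin (suc p)) (λ t → scaleP (fromℕ (surj p (toℕ t))) (binomSeries n (toℕ t)))
  powerSeries-newton n p = mk≈[] λ k k≤n → begin
    coeff (powerSeries n p) k
      ≡⟨ coeff-tab< (suc n) (λ m → powR (fromℕ m) p) k (s≤s k≤n) ⟩
    powR (fromℕ k) p
      ≈⟨ newton-R k p ⟩
    Σ< (suc p) (λ t → fromℕ (surj p t) * fromℕ (choose k t))
      ≡⟨ P.sym (ΣL-allFin (suc p) (λ t → fromℕ (surj p t) * fromℕ (choose k t))) ⟩
    ΣL (allFin (suc p)) (λ t → fromℕ (surj p (toℕ t)) * fromℕ (choose k (toℕ t)))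
      ≈⟨ ΣL-cong (allFin (suc p)) (λ t → sym (trans (coeff-scale _ (binomSeries n (toℕ t)) k)
           (*-congˡ (reflexive (coeff-tab< (suc n) (λ m → fromℕ (choose m (toℕ t))) k (s≤s k≤n)))))) ⟩
    ΣL (allFin (suc p)) (λ t → coeff (scaleP (fromℕ (surj p (toℕ t))) (binomSeries n (toℕ t))) k)
      ≈⟨ sym (coeff-ΣP (allFin (suc p)) (λ t → scaleP (fromℕ (surj p (toℕ t))) (binomSeries n (toℕ t))) k) ⟩
    coeff (ΣP (allFin (suc p)) (λ t → scaleP (fromℕ (surj p (toℕ t))) (binomSeries n (toℕ t)))) k ∎

  powerSeries-numerator : ∀ n p → ∃Deg≤ p (oneMinusX^ (suc p) ⊛ powerSeries n p) n
  powerSeries-numerator n p = record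
    { poly    = ΣP ts (λ t → scaleP (s t) (oneMinusX^ (p ∸ toℕ t) ⊛ powP X (toℕ t)))
    ; deg     = Deg-ΣP ts (λ t → Deg-scale (Deg-mono (Deg-⊛ (Deg-pow-lin 1# (- 1#) (p ∸ toℕ t)) (Deg-pow-lin 0# 1# (toℕ t)))
                                                    (ℕP.≤-reflexive (ℕP.m∸n+n≡m (FinP.toℕ≤pred[n] t)))))
    ; agrees  = ≈[]-trans (⊛-congʳ-≈[] (oneMinusX^ (suc p)) (powerSeries-newton n p))
               (≈[]-trans (≋⇒≈[] (≋-trans (⊛-ΣP ts (oneMinusX^ (suc p)) (λ t → scaleP (s t) (binomSeries n (toℕ t))))
                                          (ΣP-cong ts (λ t → ⊛-scaleʳ (s t) (oneMinusX^ (suc p)) (binomSeries n (toℕ t))))))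
               (ΣP-cong-≈[] ts (λ t → scale-cong-≈[] (binomSeries-times n p (toℕ t) (FinP.toℕ≤pred[n] t)))))
    }
    where
    ts = allFin (suc p)
    s : Fin (suc p) → Carrier
    s t = fromℕ (surj p (toℕ t))

  -- A_p agrees with (1-x)^{p+1} Σ_{m ≤ n} m^p x^m in all degrees ≤ n:
  -- in degrees ≤ p by definition, above p both sides vanish
  euler-series : ∀ n p → p ≤ n → euler p ≈[ n ] (oneMinusX^ (suc p) ⊛ powerSeries n p)
  euler-series n p p≤n = mk≈[] coefficient
    where
    open ∃Deg≤ (powerSeries-numerator n p)
    coefficient : ∀ k → k ≤ n → coeff (euler p) k ≈ coeff (oneMinusX^ (suc p) ⊛ powerSeries n p) k
    coefficient k k≤n with ℕP.≤-<-connex k p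
    ... | inj₁ k≤p = trans (reflexive (coeff-take< (suc p) (oneMinusX^ (suc p) ⊛ powerSeries p p) k (s≤s k≤p)))
                           (get≈[] (⊛-congʳ-≈[] (oneMinusX^ (suc p)) (tab-prefix (λ m → powR (fromℕ m) p) p≤n)) k k≤p)
    ... | inj₂ p<k = trans (reflexive (coeff-take≥ (suc p) (oneMinusX^ (suc p) ⊛ powerSeries p p) k p<k))
                           (sym (trans (get≈[] agrees k k≤n) (getDeg deg k p<k)))

  U-image-series : ∀ n p → p ≤ n →
    (oneMinusX^ (n ∸ p) ⊛ euler p) ≈[ n ] (oneMinusX^ (suc n) ⊛ powerSeries n p)
  U-image-series n p p≤n = ≈[]-trans (⊛-congʳ-≈[] (oneMinusX^ (n ∸ p)) (euler-series n p p≤n))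
    (≋⇒≈[] (≋-trans (≋-sym (⊛-assoc (oneMinusX^ (n ∸ p)) (oneMinusX^ (suc p)) (powerSeries n p)))
                    (⊛-congˡ (powerSeries n p) (≋-sym (oneMinusX^-split n p p≤n)))))

-- An operator given by images img p of x^p is
-- handled through the polynomial  image n img f = Σ_p f_p · img p , and the
-- coefficient vector of a composite is controlled by pairing (the weights
-- of the next operator) or by series expansions (the last operator).
module Conjugation {c ℓ} (R : CommutativeRing c ℓ) (inv : ℕ → CommutativeRing.Carrier R)
  (inv-correct : ∀ k → CommutativeRing._≈_ R (CommutativeRing._*_ R (Ops.fromℕ R inv (suc k)) (inv k))
                                              (CommutativeRing.1# R)) where
  open CommutativeRing R
  open Ops R inv
  open Series R inv inv-correct public

  -- the polynomial  Σ_{p ≤ n} f_p · img p ; linOp n img f is its coefficient vector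
  image : ∀ n → (ℕ → Poly) → Pn n → Poly
  image n img f = ΣP (allFin (suc n)) (λ p → scaleP (f p) (img (toℕ p)))

  Deg-image : ∀ n img f → (∀ p → p ≤ n → Deg (img p) n) → Deg (image n img f) n
  Deg-image n img f d = Deg-ΣP (allFin (suc n)) (λ p → Deg-scale (d (toℕ p) (FinP.toℕ≤pred[n] p)))

  pairing-image : ∀ n img (f : Pn n) w →
    pairing w (image n img f) ≈ ΣL (allFin (suc n)) (λ p → f p * pairing w (img (toℕ p)))
  pairing-image n img f w = trans (pairing-ΣP w (allFin (suc n)) (λ p → scaleP (f p) (img (toℕ p))))
    (ΣL-cong (allFin (suc n)) (λ p → pairing-scale w (f p) (img (toℕ p))))

  Σ-fromPoly : ∀ n P w → Deg P n → ΣL (allFin (suc n)) (λ p → fromPoly {n} P p * w (toℕ p)) ≈ pairing w P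
  Σ-fromPoly n P w d = trans (reflexive (ΣL-allFin (suc n) (λ s → coeff P s * w s))) (pairing-Deg n w P d)

  pairing-linOp : ∀ n img img′ (f : Pn n) w w′ →
    (∀ p → p ≤ n → Deg (img′ p) n) → (∀ p → p ≤ n → pairing w (img p) ≈ w′ p) →
    pairing w (image n img (linOp n img′ f)) ≈ pairing w′ (image n img′ f)
  pairing-linOp n img img′ f w w′ d e = begin
    pairing w (image n img (linOp n img′ f))
      ≈⟨ pairing-image n img (linOp n img′ f) w ⟩
    ΣL (allFin (suc n)) (λ p → linOp n img′ f p * pairing w (img (toℕ p)))
      ≈⟨ ΣL-cong (allFin (suc n)) (λ p → *-congˡ (e (toℕ p) (FinP.toℕ≤pred[n] p))) ⟩
    ΣL (allFin (suc n)) (λ p → fromPoly {n} (image n img′ f) p * w′ (toℕ p))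
      ≈⟨ Σ-fromPoly n (image n img′ f) w′ (Deg-image n img′ f d) ⟩
    pairing w′ (image n img′ f) ∎

  image-tab : ∀ n (φ : ℕ → ℕ → Carrier) (f : Pn n) →
    image n (λ p → tabulate {n = suc n} (λ m → φ (toℕ m) p)) f
      ≈[ n ] tabulate {n = suc n} (λ m → ΣL (allFin (suc n)) (λ p → f p * φ (toℕ m) (toℕ p)))
  image-tab n φ f = mk≈[] λ k k≤n → begin
    coeff (image n T f) k
      ≈⟨ coeff-ΣP (allFin (suc n)) (λ p → scaleP (f p) (T (toℕ p))) k ⟩
    ΣL (allFin (suc n)) (λ p → coeff (scaleP (f p) (T (toℕ p))) k)
      ≈⟨ ΣL-cong (allFin (suc n)) (λ p → trans (coeff-scale (f p) (T (toℕ p)) k)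
           (*-congˡ (reflexive (coeff-tab< (suc n) (λ m → φ m (toℕ p)) k (s≤s k≤n))))) ⟩
    ΣL (allFin (suc n)) (λ p → f p * φ k (toℕ p))
      ≡⟨ P.sym (coeff-tab< (suc n) (λ m → ΣL (allFin (suc n)) (λ p → f p * φ m (toℕ p))) k (s≤s k≤n)) ⟩
    coeff (tabulate {n = suc n} (λ m → ΣL (allFin (suc n)) (λ p → f p * φ (toℕ m) (toℕ p)))) k ∎
    where
    T : ℕ → Poly
    T p = tabulate {n = suc n} (λ m → φ (toℕ m) p)

  image-series : ∀ n img (φ : ℕ → ℕ → Carrier) (f : Pn n) →
    (∀ p → p ≤ n → img p ≈[ n ] (oneMinusX^ (suc n) ⊛ tabulate {n = suc n} (λ m → φ (toℕ m) p))) →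
    image n img f ≈[ n ]
      (oneMinusX^ (suc n) ⊛ tabulate {n = suc n} (λ m → ΣL (allFin (suc n)) (λ p → f p * φ (toℕ m) (toℕ p))))
  image-series n img φ f e =
    ≈[]-trans (ΣP-cong-≈[] ps (λ p → scale-cong-≈[] (e (toℕ p) (FinP.toℕ≤pred[n] p))))
    (≈[]-trans (≋⇒≈[] (≋-trans (ΣP-cong ps (λ p → ≋-sym (⊛-scaleʳ (f p) (oneMinusX^ (suc n)) (T (toℕ p)))))
                               (≋-sym (⊛-ΣP ps (oneMinusX^ (suc n)) (λ p → scaleP (f p) (T (toℕ p)))))))
    (⊛-congʳ-≈[] (oneMinusX^ (suc n)) (image-tab n φ f)))
    where
    ps = allFin (suc n)
    T : ℕ → Poly
    T p = tabulate {n = suc n} (λ m → φ (toℕ m) p)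

  Uinv-image V-image Vinv-image U-image : ℕ → ℕ → Poly
  Uinv-image n p = fallP p ⊛ riseP (n ∸ p)
  V-image    n p = powP onePlusX (n ∸ p) ⊛ powP X p
  Vinv-image n p = oneMinusX^ (n ∸ p) ⊛ powP X p
  U-image    n p = scaleP (invFact n) (oneMinusX^ (n ∸ p) ⊛ euler p)

  E-image : Carrier → ℕ → Poly
  E-image a p = powP (a ∷ 1# ∷ []) p

  Deg-Uinv-image : ∀ n p → p ≤ n → Deg (Uinv-image n p) n
  Deg-Uinv-image n p p≤n = Deg-mono (Deg-⊛ (Deg-fallP p) (Deg-riseP (n ∸ p))) (ℕP.≤-reflexive (ℕP.m+[n∸m]≡n p≤n))

  Deg-V-image : ∀ n p → p ≤ n → Deg (V-image n p) n
  Deg-V-image n p p≤n = Deg-mono (Deg-⊛ (Deg-pow-lin 1# 1# (n ∸ p)) (Deg-pow-lin 0# 1# p))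
                                 (ℕP.≤-reflexive (ℕP.m∸n+n≡m p≤n))

  shiftedUinv : ∀ n → Carrier → Pn n → Carrier → Carrier
  shiftedUinv n A f y = ΣL (allFin (suc n)) (λ r → f r * eval (Uinv-image n (toℕ r)) (A + y))

  eval-E-Uinv : ∀ n A (f : Pn n) y →
    ΣL (allFin (suc n)) (λ p → E n A (Uinv n f) p * powR y (toℕ p)) ≈ shiftedUinv n A f y
  eval-E-Uinv n A f y = begin
    ΣL (allFin (suc n)) (λ p → E n A (Uinv n f) p * powR y (toℕ p))
      ≈⟨ Σ-fromPoly n (image n (E-image A) (Uinv n f)) (powR y)
           (Deg-image n (E-image A) (Uinv n f) (λ p p≤n → Deg-mono (Deg-pow-lin A 1# p) p≤n)) ⟩
    eval (image n (E-image A) (Uinv n f)) y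
      ≈⟨ pairing-linOp n (E-image A) (Uinv-image n) f (powR y) (powR (A + y))
           (Deg-Uinv-image n) (λ p _ → eval-shiftPow A y p) ⟩
    eval (image n (Uinv-image n) f) (A + y)
      ≈⟨ pairing-image n (Uinv-image n) f (powR (A + y)) ⟩
    shiftedUinv n A f y ∎

  binomial-B-V : ∀ n A (f : Pn n) m →
    ΣL (allFin (suc n)) (λ t → B n A (V n f) t * fromℕ (choose m (toℕ t))) ≈ invFact n * shiftedUinv n A f (fromℕ m)
  binomial-B-V n A f m = begin
    ΣL (allFin (suc n)) (λ t → B n A (V n f) t * fromℕ (choose m (toℕ t)))
      ≈⟨ Σ-fromPoly n (image n (B-image A) (V n f)) (λ t → fromℕ (choose m t))
           (Deg-image n (B-image A) (V n f) (λ s s≤n → Deg-mono (Deg-tab s (λ i → binom A (s ∸ toℕ i))) s≤n)) ⟩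
    pairing (λ t → fromℕ (choose m t)) (image n (B-image A) (V n f))
      ≈⟨ pairing-linOp n (B-image A) (V-image n) f (λ t → fromℕ (choose m t)) (binom (A + fromℕ m))
           (Deg-V-image n) (λ s _ → pairing-B-image A m s) ⟩
    pairing (binom (A + fromℕ m)) (image n (V-image n) f)
      ≈⟨ pairing-image n (V-image n) f (binom (A + fromℕ m)) ⟩
    ΣL (allFin (suc n)) (λ r → f r * pairing (binom (A + fromℕ m)) (V-image n (toℕ r)))
      ≈⟨ ΣL-cong (allFin (suc n)) (λ r → trans
           (*-congˡ (V-image≈Uinv-image n (toℕ r) (FinP.toℕ≤pred[n] r) (A + fromℕ m)))
           (x∙yz≈y∙xz _ _ _)) ⟩
    ΣL (allFin (suc n)) (λ r → invFact n * (f r * eval (Uinv-image n (toℕ r)) (A + fromℕ m)))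
      ≈⟨ ΣL-*ˡ (allFin (suc n)) (invFact n) _ ⟩
    invFact n * shiftedUinv n A f (fromℕ m) ∎

  U-image-expansion : ∀ n p → p ≤ n → U-image n p ≈[ n ]
    (oneMinusX^ (suc n) ⊛ tabulate {n = suc n} (λ m → invFact n * powR (fromℕ (toℕ m)) p))
  U-image-expansion n p p≤n = ≈[]-trans (scale-cong-≈[] (U-image-series n p p≤n))
    (≋⇒≈[] (≋-trans (≋-sym (⊛-scaleʳ (invFact n) (oneMinusX^ (suc n)) (powerSeries n p)))
                    (⊛-congʳ (oneMinusX^ (suc n)) (tab-scale (suc n) (invFact n) (λ m → powR (fromℕ m) p)))))

  Vinv-image-expansion : ∀ n t → t ≤ n → Vinv-image n t ≈[ n ] (oneMinusX^ (suc n) ⊛ binomSeries n t)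
  Vinv-image-expansion n t t≤n = ≈[]-sym (binomSeries-times n n t t≤n)

  common-series : ∀ n → Carrier → Pn n → Poly
  common-series n A f = oneMinusX^ (suc n) ⊛
    tabulate {n = suc n} (λ m → invFact n * shiftedUinv n A f (fromℕ (toℕ m)))

  G-series : ∀ n A (f : Pn n) → image n (U-image n) (E n A (Uinv n f)) ≈[ n ] common-series n A f
  G-series n A f = ≈[]-trans
    (image-series n (U-image n) (λ m p → invFact n * powR (fromℕ m) p) v (U-image-expansion n))
    (≋⇒≈[] (⊛-congʳ (oneMinusX^ (suc n)) (tab-cong (suc n) λ m → begin
      ΣL ps (λ p → v p * (invFact n * powR (fromℕ m) (toℕ p)))  ≈⟨ ΣL-cong ps (λ p → x∙yz≈y∙xz _ _ _) ⟩
      ΣL ps (λ p → invFact n * (v p * powR (fromℕ m) (toℕ p)))  ≈⟨ ΣL-*ˡ ps (invFact n) _ ⟩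
      invFact n * ΣL ps (λ p → v p * powR (fromℕ m) (toℕ p))    ≈⟨ *-congˡ (eval-E-Uinv n A f (fromℕ m)) ⟩
      invFact n * shiftedUinv n A f (fromℕ m)                   ∎)))
    where
    ps = allFin (suc n)
    v = E n A (Uinv n f)

  conjugate-series : ∀ n A (f : Pn n) → image n (Vinv-image n) (B n A (V n f)) ≈[ n ] common-series n A f
  conjugate-series n A f = ≈[]-trans
    (image-series n (Vinv-image n) (λ m t → fromℕ (choose m t)) (B n A (V n f)) (Vinv-image-expansion n))
    (≋⇒≈[] (⊛-congʳ (oneMinusX^ (suc n)) (tab-cong (suc n) (binomial-B-V n A f))))

theorem16 : ∀ {c ℓ} (R : CommutativeRing c ℓ) (inv : ℕ → CommutativeRing.Carrier R) →
    let open CommutativeRing R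
        open Ops R inv
    in (∀ k → fromℕ (suc k) * inv k ≈ 1#) →
       ∀ (n : ℕ) (β : Carrier) (f : Pn n) (i : Fin (suc n)) →
       G n β f i ≈ Vinv n (B n (fromℕ n * β) (V n f)) i
theorem16 R inv inv-correct n β f i =
  trans (get≈[] (G-series n A f) (toℕ i) i≤n) (sym (get≈[] (conjugate-series n A f) (toℕ i) i≤n))
  where
  open CommutativeRing R
  open Ops R inv
  open Conjugation R inv inv-correct
  A = fromℕ n * β
  i≤n = FinP.toℕ≤pred[n] i
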